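{- (1) For every $\mathsf{PTS}\alpha$ term $t$: $\mathcal B(\mathcal A(t))=t$. (2) For every $\mathsf{PTSC}\alpha$ term $M$: $M\to_{\mathsf{x}'}^*\mathcal A(\mathcal B(M))$.
   Context: Fix a set $\mathcal S$ of sorts, a denumerable set of variables, and two denumerable sets of meta-variables: term meta-variables $\alpha$ and list meta-variables $\beta$, each with a fixed arity. $\mathsf{PTSC}\alpha$ terms and lists: $M ::= \Pi x^{A}.B \mid \lambda x^{A}.M \mid s \mid x\,l \mid M\,l \mid \langle N/x\rangle_A M \mid \alpha(M_1,\dots,M_n)$, $l ::= [\,] \mid M\cdot l \mid l @ l' \mid \langle N/x\rangle_A l \mid \beta(M_1,\dots,M_n)$ ($\langle N/x\rangle_A$ explicit substitution binding $x$; $\Pi,\lambda$ bind $x$; up to $\alpha$-conversion). System $\mathsf{x}'$: (B1) $M\,[\,]\to M$; (B2) $(x\,l)\,l'\to x\,(l@l')$; (B3) $(M\,l)\,l'\to M\,(l@l')$; (A1) $(M\cdot l')@l\to M\cdot(l'@l)$; (A2) $[\,]@l\to l$; (A3) $(l@l')@l''\to l@(l'@l'')$; (A4) $l@[\,]\to l$; (C1) $\langle P/y\rangle_G(\lambda x^A.M)\to\lambda x^{\langle P/y\rangle_G A}.\langle P/y\rangle_G M$; (C2) $\langle P/y\rangle_G(y\,l)\to P\,(\langle P/y\rangle_G l)$; (C3) $\langle P/y\rangle_G(x\,l)\to x\,(\langle P/y\rangle_G l)$ if $x\neq y$; (C4) $\langle P/y\rangle_G(M\,l)\to(\langle P/y\rangle_G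 M)\,(\langle P/y\rangle_G l)$; (C5) $\langle P/y\rangle_G(\Pi x^A.B)\to\Pi x^{\langle P/y\rangle_G A}.\langle P/y\rangle_G B$; (C6) $\langle P/y\rangle_G s\to s$; (C$\alpha$) $\langle P/y\rangle_G\alpha(M_1,\dots,M_n)\to\alpha(\langle P/y\rangle_G M_1,\dots)$; (D1) $\langle P/y\rangle_G[\,]\to[\,]$; (D2) $\langle P/y\rangle_G(M\cdot l)\to(\langle P/y\rangle_G M)\cdot(\langle P/y\rangle_G l)$; (D3) $\langle P/y\rangle_G(l@l')\to(\langle P/y\rangle_G l)@(\langle P/y\rangle_G l')$; (D$\beta$) $\langle P/y\rangle_G\beta(M_1,\dots,M_n)\to\beta(\langle P/y\rangle_G M_1,\dots)$; $\to_{\mathsf{x}'}$ is the contextual closure, $\to^*_{\mathsf{x}'}$ its reflexive-transitive closure. PTS terms $t,u,T ::= x\mid s\mid\Pi x^T.t\mid\lambda x^T.t\mid t\,u$; $t\{x:=u\}$ is capture-avoiding substitution. For each term (resp. list) meta-variable $\alpha$ (resp. $\beta$) of arity $k$ a PTS variable $\alpha^k$ (resp. $\beta^k$) is reserved. $\mathsf{PTS}\alpha$ is the set of PTS terms in which no reserved variable is bound, each $\alpha^k$ is applied to at least $k$ arguments and each $\beta^k$ to at least $k+1$ arguments. Translation $\mathcal B$: $\mathcal B(\Pi x^A.B)=\Pi x^{\mathcal B(A)}.\mathcal B(B)$, $\mathcal B(\lambda x^A.M)=\lambda x^{\mathcal B(A)}.\mathcal B(M)$, $\mathcal B(s)=s$,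 $\mathcal B(x\,l)=\mathcal B^z(l)\{z:=x\}$, $\mathcal B(M\,l)=\mathcal B^z(l)\{z:=\mathcal B(M)\}$ ($z$ fresh), $\mathcal B(\langle P/x\rangle_K M)=\mathcal B(M)\{x:=\mathcal B(P)\}$, $\mathcal B(\alpha(M_1,\dots,M_n))=\alpha^n\,\mathcal B(M_1)\cdots\mathcal B(M_n)$; $\mathcal B^y([\,])=y$, $\mathcal B^y(M\cdot l)=\mathcal B^z(l)\{z:=y\,\mathcal B(M)\}$, $\mathcal B^y(l@l')=\mathcal B^z(l')\{z:=\mathcal B^y(l)\}$ ($z$ fresh), $\mathcal B^y(\langle P/x\rangle_K l)=\mathcal B^y(l)\{x:=\mathcal B(P)\}$, $\mathcal B^y(\beta(M_1,\dots,M_n))=\beta^n\,y\,\mathcal B(M_1)\cdots\mathcal B(M_n)$. Translation $\mathcal A$: $\mathcal A(s)=s$, $\mathcal A(\Pi x^T.U)=\Pi x^{\mathcal A(T)}.\mathcal A(U)$, $\mathcal A(\lambda x^T.t)=\lambda x^{\mathcal A(T)}.\mathcal A(t)$, $\mathcal A(\alpha^k\,t_1\cdots t_k)=\alpha(\mathcal A(t_1),\dots,\mathcal A(t_k))$, $\mathcal A(\beta^k\,t\,t_1\cdots t_k)=\mathcal A_{\beta(\mathcal A(t_1),\dots,\mathcal A(t_k))}(t)$, $\mathcal A(t)=\mathcal A_{[\,]}(t)$ otherwise; $\mathcal A_l(\alpha^k\,t_1\cdots t_k)=\alpha(\mathcal A(t_1),\dots,\mathcal A(t_k))\,l$, $\mathcal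 A_l(\beta^k\,t\,t_1\cdots t_k)=\mathcal A_{\beta(\mathcal A(t_1),\dots,\mathcal A(t_k))@l}(t)$, $\mathcal A_l(t\,u)=\mathcal A_{\mathcal A(u)\cdot l}(t)$ otherwise, $\mathcal A_l(x)=x\,l$, $\mathcal A_l(t)=\mathcal A(t)\,l$ otherwise (in the displayed $\alpha^k$, $\beta^k$ cases the reserved variable is applied to exactly $k$, resp. $k+1$, arguments). -}

module Defs where

-- Conventions:
--  * terms are taken up to alpha-conversion, represented with de Bruijn indices (ℕ);
--  * the set of sorts is an arbitrary type S;
--  * a term (resp. list) meta-variable is a pair (name : ℕ, arity : ℕ); its arity is the
--    length of the argument vector;
--  * the reserved PTS variable α^k (resp. β^k) of the meta-variable (a , k) is the
--    separate variable constructor  resα a k  (resp. resβ a k); as it is not a de Bruijn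
--    variable, it can never be bound.

open import Data.Nat using (ℕ; zero; suc; _+_; _*_; _≤_)
open import Data.List using (List; []; _∷_; _++_; [_])
open import Data.Vec using (Vec; []; _∷_)
import Data.Vec as Vec
open import Data.Maybe using (Maybe; just; nothing)
import Data.Maybe as Maybe
open import Data.Product using (Σ; _×_; _,_)
open import Data.Unit using (⊤)
open import Relation.Binary.Construct.Closure.ReflexiveTransitive using (Star)

private variable
  S : Set
  n : ℕ

data PTS (S : Set) : Set where
  var  : ℕ → PTS S
  resα : ℕ → ℕ → PTS S
  resβ : ℕ → ℕ → PTS S
  sort : S → PTS S
  pi   : PTS S → PTS S → PTS S     -- Π x^T . U   (U under one binder)
  lam  : PTS S → PTS S → PTS S     -- λ x^T . t   (t under one binder)
  app  : PTS S → PTS S → PTS S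

ext : (ℕ → ℕ) → ℕ → ℕ
ext ρ zero    = zero
ext ρ (suc i) = suc (ρ i)

ren : (ℕ → ℕ) → PTS S → PTS S
ren ρ (var i)    = var (ρ i)
ren ρ (resα a k) = resα a k
ren ρ (resβ b k) = resβ b k
ren ρ (sort s)   = sort s
ren ρ (pi T U)   = pi (ren ρ T) (ren (ext ρ) U)
ren ρ (lam T t)  = lam (ren ρ T) (ren (ext ρ) t)
ren ρ (app t u)  = app (ren ρ t) (ren ρ u)

wk : PTS S → PTS S
wk = ren suc

exts : (ℕ → PTS S) → ℕ → PTS S
exts σ zero    = var zero
exts σ (suc i) = wk (σ i)

sub : (ℕ → PTS S) → PTS S → PTS S
sub σ (var i)    = σ i
sub σ (resα a k) = resα a k
sub σ (resβ b k) = resβ b k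
sub σ (sort s)   = sort s
sub σ (pi T U)   = pi (sub σ T) (sub (exts σ) U)
sub σ (lam T t)  = lam (sub σ T) (sub (exts σ) t)
sub σ (app t u)  = app (sub σ t) (sub σ u)

_⟦_⟧ : PTS S → PTS S → PTS S
t ⟦ u ⟧ = sub σ t
  where σ : ℕ → PTS _
        σ zero    = u
        σ (suc i) = var i

mutual
  data Tm (S : Set) : Set where
    cPi   : Tm S → Tm S → Tm S              -- Π x^A . B     (B under binder)
    cLam  : Tm S → Tm S → Tm S              -- λ x^A . M     (M under binder)
    cSort : S → Tm S
    cVar  : ℕ → Lst S → Tm S
    cApp  : Tm S → Lst S → Tm S
    cSub  : Tm S → Tm S → Tm S → Tm S       -- cSub N A M = ⟨N/x⟩_A M   (M under binder)
    cMeta : ℕ → {n : ℕ} → Vec (Tm S) n → Tm S        -- α(M₁,…,Mₙ), α = (name , n)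

  data Lst (S : Set) : Set where
    lNil  : Lst S
    lCons : Tm S → Lst S → Lst S
    lCat  : Lst S → Lst S → Lst S
    lSub  : Tm S → Tm S → Lst S → Lst S     -- lSub N A l = ⟨N/x⟩_A l   (l under binder)
    lMeta : ℕ → {n : ℕ} → Vec (Tm S) n → Lst S       -- β(M₁,…,Mₙ), β = (name , n)

-- renaming of PTSC terms (needed to state C1, C5 with de Bruijn indices)
mutual
  renT : (ℕ → ℕ) → Tm S → Tm S
  renT ρ (cPi A B)    = cPi (renT ρ A) (renT (ext ρ) B)
  renT ρ (cLam A M)   = cLam (renT ρ A) (renT (ext ρ) M)
  renT ρ (cSort s)    = cSort s
  renT ρ (cVar x l)   = cVar (ρ x) (renL ρ l)
  renT ρ (cApp M l)   = cApp (renT ρ M) (renL ρ l)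
  renT ρ (cSub N A M) = cSub (renT ρ N) (renT ρ A) (renT (ext ρ) M)
  renT ρ (cMeta a Ms) = cMeta a (renV ρ Ms)

  renL : (ℕ → ℕ) → Lst S → Lst S
  renL ρ lNil         = lNil
  renL ρ (lCons M l)  = lCons (renT ρ M) (renL ρ l)
  renL ρ (lCat l l')  = lCat (renL ρ l) (renL ρ l')
  renL ρ (lSub N A l) = lSub (renT ρ N) (renT ρ A) (renL (ext ρ) l)
  renL ρ (lMeta b Ms) = lMeta b (renV ρ Ms)

  renV : (ℕ → ℕ) → Vec (Tm S) n → Vec (Tm S) n
  renV ρ []       = []
  renV ρ (M ∷ Ms) = renT ρ M ∷ renV ρ Ms

wkT : Tm S → Tm S
wkT = renT suc

swap : ℕ → ℕ
swap zero          = suc zero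
swap (suc zero)    = zero
swap (suc (suc i)) = suc (suc i)

mutual
  infix 4 _⟶_ _⟶ₗ_ _⟶ᵥ_

  data _⟶_ {S : Set} : Tm S → Tm S → Set where
    B1  : ∀ {M} → cApp M lNil ⟶ M
    B2  : ∀ {x l l'} → cApp (cVar x l) l' ⟶ cVar x (lCat l l')
    B3  : ∀ {M l l'} → cApp (cApp M l) l' ⟶ cApp M (lCat l l')
    C1  : ∀ {P G A M} → cSub P G (cLam A M) ⟶
            cLam (cSub P G A) (cSub (wkT P) (wkT G) (renT swap M))
    C2  : ∀ {P G l} → cSub P G (cVar zero l) ⟶ cApp P (lSub P G l)
    C3  : ∀ {P G x l} → cSub P G (cVar (suc x) l) ⟶ cVar x (lSub P G l)
    C4  : ∀ {P G M l} → cSub P G (cApp M l) ⟶ cApp (cSub P G M) (lSub P G l)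
    C5  : ∀ {P G A B} → cSub P G (cPi A B) ⟶
            cPi (cSub P G A) (cSub (wkT P) (wkT G) (renT swap B))
    C6  : ∀ {P G s} → cSub P G (cSort s) ⟶ cSort s
    Cα  : ∀ {P G a n} {Ms : Vec (Tm S) n} →
            cSub P G (cMeta a Ms) ⟶ cMeta a (Vec.map (cSub P G) Ms)
    piˡ  : ∀ {A A' B} → A ⟶ A' → cPi A B ⟶ cPi A' B
    piʳ  : ∀ {A B B'} → B ⟶ B' → cPi A B ⟶ cPi A B'
    lamˡ : ∀ {A A' M} → A ⟶ A' → cLam A M ⟶ cLam A' M
    lamʳ : ∀ {A M M'} → M ⟶ M' → cLam A M ⟶ cLam A M'
    var  : ∀ {x l l'} → l ⟶ₗ l' → cVar x l ⟶ cVar x l'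
    appˡ : ∀ {M M' l} → M ⟶ M' → cApp M l ⟶ cApp M' l
    appʳ : ∀ {M l l'} → l ⟶ₗ l' → cApp M l ⟶ cApp M l'
    sub₁ : ∀ {N N' A M} → N ⟶ N' → cSub N A M ⟶ cSub N' A M
    sub₂ : ∀ {N A A' M} → A ⟶ A' → cSub N A M ⟶ cSub N A' M
    sub₃ : ∀ {N A M M'} → M ⟶ M' → cSub N A M ⟶ cSub N A M'
    meta : ∀ {a n} {Ms Ms' : Vec (Tm S) n} → Ms ⟶ᵥ Ms' → cMeta a Ms ⟶ cMeta a Ms'

  data _⟶ₗ_ {S : Set} : Lst S → Lst S → Set where
    A1  : ∀ {M l' l} → lCat (lCons M l') l ⟶ₗ lCons M (lCat l' l)
    A2  : ∀ {l} → lCat lNil l ⟶ₗ l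
    A3  : ∀ {l l' l''} → lCat (lCat l l') l'' ⟶ₗ lCat l (lCat l' l'')
    A4  : ∀ {l} → lCat l lNil ⟶ₗ l
    D1  : ∀ {P G} → lSub P G lNil ⟶ₗ lNil
    D2  : ∀ {P G M l} → lSub P G (lCons M l) ⟶ₗ lCons (cSub P G M) (lSub P G l)
    D3  : ∀ {P G l l'} → lSub P G (lCat l l') ⟶ₗ lCat (lSub P G l) (lSub P G l')
    Dβ  : ∀ {P G b n} {Ms : Vec (Tm S) n} →
            lSub P G (lMeta b Ms) ⟶ₗ lMeta b (Vec.map (cSub P G) Ms)
    consˡ : ∀ {M M' l} → M ⟶ M' → lCons M l ⟶ₗ lCons M' l
    consʳ : ∀ {M l l'} → l ⟶ₗ l' → lCons M l ⟶ₗ lCons M l'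
    catˡ  : ∀ {l₁ l₁' l₂} → l₁ ⟶ₗ l₁' → lCat l₁ l₂ ⟶ₗ lCat l₁' l₂
    catʳ  : ∀ {l₁ l₂ l₂'} → l₂ ⟶ₗ l₂' → lCat l₁ l₂ ⟶ₗ lCat l₁ l₂'
    sub₁  : ∀ {N N' A l} → N ⟶ N' → lSub N A l ⟶ₗ lSub N' A l
    sub₂  : ∀ {N A A' l} → A ⟶ A' → lSub N A l ⟶ₗ lSub N A' l
    sub₃  : ∀ {N A l l'} → l ⟶ₗ l' → lSub N A l ⟶ₗ lSub N A l'
    meta  : ∀ {b n} {Ms Ms' : Vec (Tm S) n} → Ms ⟶ᵥ Ms' → lMeta b Ms ⟶ₗ lMeta b Ms'

  data _⟶ᵥ_ {S : Set} : {n : ℕ} → Vec (Tm S) n → Vec (Tm S) n → Set where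
    here  : ∀ {n M M'} {Ms : Vec (Tm S) n} → M ⟶ M' → (M ∷ Ms) ⟶ᵥ (M' ∷ Ms)
    there : ∀ {n M} {Ms Ms' : Vec (Tm S) n} → Ms ⟶ᵥ Ms' → (M ∷ Ms) ⟶ᵥ (M ∷ Ms')

infix 4 _⟶*_
_⟶*_ : Tm S → Tm S → Set
_⟶*_ = Star _⟶_

-- Translation B : PTSCα → PTS
-- Bl l  is  B^z(l)  where the fresh variable z is de Bruijn index 0 (the other
-- free variables of l are shifted up by one).

mutual
  B : Tm S → PTS S
  B (cPi A B')   = pi (B A) (B B')
  B (cLam A M)   = lam (B A) (B M)
  B (cSort s)    = sort s
  B (cVar x l)   = Bl l ⟦ var x ⟧
  B (cApp M l)   = Bl l ⟦ B M ⟧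
  B (cSub P K M) = B M ⟦ B P ⟧
  B (cMeta a {n} Ms) = Bapps (resα a n) Ms

  Bl : Lst S → PTS S
  Bl lNil         = var zero
  Bl (lCons M l)  = sub σ (Bl l)
    where σ : ℕ → PTS _
          σ zero    = app (var zero) (wk (B M))
          σ (suc i) = var (suc i)
  Bl (lCat l l')  = sub σ (Bl l')
    where σ : ℕ → PTS _
          σ zero    = Bl l
          σ (suc i) = var (suc i)
  Bl (lSub P K l) = sub σ (Bl l)
    where σ : ℕ → PTS _
          σ zero          = var zero
          σ (suc zero)    = wk (B P)
          σ (suc (suc i)) = var (suc i)
  Bl (lMeta b {n} Ms) = Bappsʷ (app (resβ b n) (var zero)) Ms

  Bapps : PTS S → Vec (Tm S) n → PTS S
  Bapps h []       = h
  Bapps h (M ∷ Ms) = Bapps (app h (B M)) Ms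

  Bappsʷ : PTS S → Vec (Tm S) n → PTS S
  Bappsʷ h []       = h
  Bappsʷ h (M ∷ Ms) = Bappsʷ (app h (wk (B M))) Ms

-- PTSα : no reserved variable bound (automatic: reserved variables are not de Bruijn
-- variables), each α^k applied to at least k arguments, each β^k to at least k+1.
-- WFα m t : t is well formed when it occurs applied to m further arguments.

WFα : ℕ → PTS S → Set
WFα m (var x)    = ⊤
WFα m (resα a k) = k ≤ m
WFα m (resβ b k) = suc k ≤ m
WFα m (sort s)   = ⊤
WFα m (pi T U)   = WFα 0 T × WFα 0 U
WFα m (lam T t)  = WFα 0 T × WFα 0 t
WFα m (app t u)  = WFα (suc m) t × WFα 0 u

PTSα : PTS S → Set
PTSα t = WFα 0 t

spine : PTS S → PTS S × List (PTS S)
spine (app t u) with spine t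
... | h , as = h , (as ++ [ u ])
spine t = t , []

exactly : {X : Set} (k : ℕ) → List X → Maybe (Vec X k)
exactly zero    []       = just []
exactly zero    (_ ∷ _)  = nothing
exactly (suc k) []       = nothing
exactly (suc k) (x ∷ xs) = Maybe.map (x ∷_) (exactly k xs)

isα : PTS S → Maybe (Σ ℕ λ a → Σ ℕ λ k → Vec (PTS S) k)
isα t with spine t
... | resα a k , as = Maybe.map (λ v → a , k , v) (exactly k as)
... | _ = nothing

isβ : PTS S → Maybe (Σ ℕ λ b → Σ ℕ λ k → PTS S × Vec (PTS S) k)
isβ t with spine t
... | resβ b k , (t₀ ∷ as) = Maybe.map (λ v → b , k , t₀ , v) (exactly k as)
... | _ = nothing

-- The paper's mutually recursive A and A_l are not structurally recursive (A(t) calls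
-- A_[](t) on the same t, and the arguments tᵢ of a spine are not immediate subterms),
-- so they are defined with a fuel argument; the fuel 3·size(t) used below is enough
-- for every call on a PTSα term (each clause consumes one unit).  junk is only
-- reached by ill-formed (non-PTSα) inputs.

size : PTS S → ℕ
size (pi T U)  = suc (size T + size U)
size (lam T t) = suc (size T + size t)
size (app t u) = suc (size t + size u)
size _         = 1

junk : Tm S
junk = cVar zero lNil

mutual
  Aₙ : ℕ → PTS S → Tm S
  Aₙ zero    t         = junk
  Aₙ (suc n) (sort s)  = cSort s
  Aₙ (suc n) (pi T U)  = cPi (Aₙ n T) (Aₙ n U)
  Aₙ (suc n) (lam T t) = cLam (Aₙ n T) (Aₙ n t)
  Aₙ (suc n) t = A-rest n t (isα t) (isβ t)

  A-rest : ℕ → PTS S → Maybe (Σ ℕ λ a → Σ ℕ λ k → Vec (PTS S) k)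
         → Maybe (Σ ℕ λ b → Σ ℕ λ k → PTS S × Vec (PTS S) k) → Tm S
  A-rest n t (just (a , k , ts)) _ = cMeta a (Vec.map (Aₙ n) ts)
  A-rest n t nothing (just (b , k , t₀ , ts)) = Aₗₙ n (lMeta b (Vec.map (Aₙ n) ts)) t₀
  A-rest n t nothing nothing = Aₗₙ n lNil t

  Aₗₙ : ℕ → Lst S → PTS S → Tm S
  Aₗₙ zero    l t = junk
  Aₗₙ (suc n) l t = Aₗ-rest n l t (isα t) (isβ t)

  Aₗ-rest : ℕ → Lst S → PTS S → Maybe (Σ ℕ λ a → Σ ℕ λ k → Vec (PTS S) k)
          → Maybe (Σ ℕ λ b → Σ ℕ λ k → PTS S × Vec (PTS S) k) → Tm S
  Aₗ-rest n l t (just (a , k , ts)) _ = cApp (cMeta a (Vec.map (Aₙ n) ts)) l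
  Aₗ-rest n l t nothing (just (b , k , t₀ , ts)) =
    Aₗₙ n (lCat (lMeta b (Vec.map (Aₙ n) ts)) l) t₀
  Aₗ-rest n l (app t u) nothing nothing = Aₗₙ n (lCons (Aₙ n u) l) t
  Aₗ-rest n l (var x)   nothing nothing = cVar x l
  Aₗ-rest n l t         nothing nothing = cApp (Aₙ n t) l

A : PTS S → Tm S
A t = Aₙ (3 * size t) t

Aₗ : Lst S → PTS S → Tm S
Aₗ l t = Aₗₙ (3 * size t) l t

module Submission where

-- A is defined in Defs with fuel, since its recursion is not structural.  Rather than
-- computing with it, we describe it by its graph: relations t ⇝ M ("A(t) = M") and
-- t ⇝[ l ] M ("A_l(t) = M") whose constructors are the defining equations of A and A_l.
-- The proof rests on three properties of the graph:
--   * given fuel 3·size t, the fuelled functions follow the graph, hence t ⇝ A(t);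
--   * the graph is functional;
--   * B inverts it: t ⇝ M implies B(M) = t, which is part (1).
-- For part (2), every term reduces to an x'-normal form N, B is invariant under x', and
-- B(N) ⇝ N for normal N; functionality gives A(B(M)) = A(B(N)) = N.

open import Defs
open import Data.Nat using (ℕ; zero; suc; _+_; _*_; _≤_; _<_; s≤s; z≤n; _≟_)
open import Data.Nat.Properties
  using ( ≤-refl; ≤-trans; ≤-pred; ≤∧≢⇒<; n≤1+n; m≤m+n; m≤n+m
        ; m+n≤o⇒m≤o; m+n≤o⇒n≤o; +-cancelˡ-≤; +-monoˡ-≤; *-monoʳ-≤; *-suc
        ; suc-injective; +-identityʳ; +-suc; +-comm; 1+n≰n; module ≤-Reasoning )
open import Data.List using (List; []; _∷_; _++_; [_]; foldl; length)
open import Data.List.Properties using (foldl-∷ʳ; ++-identityʳ; ++-assoc; length-++)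
open import Data.List.Relation.Unary.All using (All; []; _∷_)
import Data.List.Relation.Unary.All as All
open import Data.Vec using (Vec; []; _∷_; toList)
import Data.Vec as Vec
open import Data.Vec.Properties using (length-toList)
open import Data.Maybe using (Maybe; just; nothing)
import Data.Maybe as Maybe
open import Data.Product using (Σ; Σ-syntax; _×_; _,_; proj₁; proj₂)
open import Data.Sum using (_⊎_; inj₁; inj₂)
open import Data.Empty using (⊥-elim)
open import Data.Unit using (tt)
open import Function using (case_of_)
open import Relation.Nullary using (yes; no)
open import Relation.Binary.PropositionalEquality hiding ([_])
open import Relation.Binary.Construct.Closure.ReflexiveTransitive using (Star; ε; _◅_; _◅◅_; gmap)

private variable
  S : Set
  n n' : ℕ

-- Substitution calculus of PTS terms.  Congruence of renaming and substitution under
-- pointwise equal maps, needed because ext and exts only commute with composition pointwise.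
ext-cong : {ρ ρ' : ℕ → ℕ} → ρ ≗ ρ' → ext ρ ≗ ext ρ'
ext-cong h zero    = refl
ext-cong h (suc i) = cong suc (h i)

exts-cong : {σ σ' : ℕ → PTS S} → σ ≗ σ' → exts σ ≗ exts σ'
exts-cong h zero    = refl
exts-cong h (suc i) = cong wk (h i)

ren-cong : {ρ ρ' : ℕ → ℕ} → ρ ≗ ρ' → (t : PTS S) → ren ρ t ≡ ren ρ' t
ren-cong h (var i)    = cong var (h i)
ren-cong h (resα a k) = refl
ren-cong h (resβ b k) = refl
ren-cong h (sort s)   = refl
ren-cong h (pi T U)   = cong₂ pi (ren-cong h T) (ren-cong (ext-cong h) U)
ren-cong h (lam T t)  = cong₂ lam (ren-cong h T) (ren-cong (ext-cong h) t)
ren-cong h (app t u)  = cong₂ app (ren-cong h t) (ren-cong h u)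

sub-cong : {σ σ' : ℕ → PTS S} → σ ≗ σ' → (t : PTS S) → sub σ t ≡ sub σ' t
sub-cong h (var i)    = h i
sub-cong h (resα a k) = refl
sub-cong h (resβ b k) = refl
sub-cong h (sort s)   = refl
sub-cong h (pi T U)   = cong₂ pi (sub-cong h T) (sub-cong (exts-cong h) U)
sub-cong h (lam T t)  = cong₂ lam (sub-cong h T) (sub-cong (exts-cong h) t)
sub-cong h (app t u)  = cong₂ app (sub-cong h t) (sub-cong h u)

ren-ren : (ρ ρ' : ℕ → ℕ) (t : PTS S) → ren ρ (ren ρ' t) ≡ ren (λ i → ρ (ρ' i)) t
ren-ren ρ ρ' (var i)    = refl
ren-ren ρ ρ' (resα a k) = refl
ren-ren ρ ρ' (resβ b k) = refl
ren-ren ρ ρ' (sort s)   = refl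
ren-ren ρ ρ' (pi T U)   = cong₂ pi (ren-ren ρ ρ' T)
  (trans (ren-ren (ext ρ) (ext ρ') U) (ren-cong (λ { zero → refl ; (suc i) → refl }) U))
ren-ren ρ ρ' (lam T t)  = cong₂ lam (ren-ren ρ ρ' T)
  (trans (ren-ren (ext ρ) (ext ρ') t) (ren-cong (λ { zero → refl ; (suc i) → refl }) t))
ren-ren ρ ρ' (app t u)  = cong₂ app (ren-ren ρ ρ' t) (ren-ren ρ ρ' u)

wk-ren : (ρ : ℕ → ℕ) (t : PTS S) → ren (ext ρ) (wk t) ≡ wk (ren ρ t)
wk-ren ρ t = trans (ren-ren (ext ρ) suc t) (sym (ren-ren suc ρ t))

ren-sub : (ρ : ℕ → ℕ) (σ : ℕ → PTS S) (t : PTS S) → ren ρ (sub σ t) ≡ sub (λ i → ren ρ (σ i)) t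
ren-sub ρ σ (var i)    = refl
ren-sub ρ σ (resα a k) = refl
ren-sub ρ σ (resβ b k) = refl
ren-sub ρ σ (sort s)   = refl
ren-sub ρ σ (pi T U)   = cong₂ pi (ren-sub ρ σ T)
  (trans (ren-sub (ext ρ) (exts σ) U) (sub-cong (λ { zero → refl ; (suc i) → wk-ren ρ (σ i) }) U))
ren-sub ρ σ (lam T t)  = cong₂ lam (ren-sub ρ σ T)
  (trans (ren-sub (ext ρ) (exts σ) t) (sub-cong (λ { zero → refl ; (suc i) → wk-ren ρ (σ i) }) t))
ren-sub ρ σ (app t u)  = cong₂ app (ren-sub ρ σ t) (ren-sub ρ σ u)

sub-ren : (σ : ℕ → PTS S) (ρ : ℕ → ℕ) (t : PTS S) → sub σ (ren ρ t) ≡ sub (λ i → σ (ρ i)) t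
sub-ren σ ρ (var i)    = refl
sub-ren σ ρ (resα a k) = refl
sub-ren σ ρ (resβ b k) = refl
sub-ren σ ρ (sort s)   = refl
sub-ren σ ρ (pi T U)   = cong₂ pi (sub-ren σ ρ T)
  (trans (sub-ren (exts σ) (ext ρ) U) (sub-cong (λ { zero → refl ; (suc i) → refl }) U))
sub-ren σ ρ (lam T t)  = cong₂ lam (sub-ren σ ρ T)
  (trans (sub-ren (exts σ) (ext ρ) t) (sub-cong (λ { zero → refl ; (suc i) → refl }) t))
sub-ren σ ρ (app t u)  = cong₂ app (sub-ren σ ρ t) (sub-ren σ ρ u)

sub-wk : (σ : ℕ → PTS S) (t : PTS S) → sub (exts σ) (wk t) ≡ wk (sub σ t)
sub-wk σ t = trans (sub-ren (exts σ) suc t) (sym (ren-sub suc σ t))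

sub-sub : (σ τ : ℕ → PTS S) (t : PTS S) → sub σ (sub τ t) ≡ sub (λ i → sub σ (τ i)) t
sub-sub σ τ (var i)    = refl
sub-sub σ τ (resα a k) = refl
sub-sub σ τ (resβ b k) = refl
sub-sub σ τ (sort s)   = refl
sub-sub σ τ (pi T U)   = cong₂ pi (sub-sub σ τ T)
  (trans (sub-sub (exts σ) (exts τ) U) (sub-cong (λ { zero → refl ; (suc i) → sub-wk σ (τ i) }) U))
sub-sub σ τ (lam T t)  = cong₂ lam (sub-sub σ τ T)
  (trans (sub-sub (exts σ) (exts τ) t) (sub-cong (λ { zero → refl ; (suc i) → sub-wk σ (τ i) }) t))
sub-sub σ τ (app t u)  = cong₂ app (sub-sub σ τ t) (sub-sub σ τ u)

sub-var : {σ : ℕ → PTS S} {ρ : ℕ → ℕ} → σ ≗ (λ i → var (ρ i)) → (t : PTS S) → sub σ t ≡ ren ρ t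
sub-var h (var i)    = h i
sub-var h (resα a k) = refl
sub-var h (resβ b k) = refl
sub-var h (sort s)   = refl
sub-var h (pi T U)   = cong₂ pi (sub-var h T) (sub-var (λ { zero → refl ; (suc i) → cong wk (h i) }) U)
sub-var h (lam T t)  = cong₂ lam (sub-var h T) (sub-var (λ { zero → refl ; (suc i) → cong wk (h i) }) t)
sub-var h (app t u)  = cong₂ app (sub-var h t) (sub-var h u)

sub-id : {σ : ℕ → PTS S} → σ ≗ var → (t : PTS S) → sub σ t ≡ t
sub-id h (var i)    = h i
sub-id h (resα a k) = refl
sub-id h (resβ b k) = refl
sub-id h (sort s)   = refl
sub-id h (pi T U)   = cong₂ pi (sub-id h T) (sub-id (λ { zero → refl ; (suc i) → cong wk (h i) }) U)
sub-id h (lam T t)  = cong₂ lam (sub-id h T) (sub-id (λ { zero → refl ; (suc i) → cong wk (h i) }) t)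
sub-id h (app t u)  = cong₂ app (sub-id h t) (sub-id h u)

sub-sub-cong : (σ τ σ' τ' : ℕ → PTS S) (t : PTS S) →
  (λ i → sub σ (τ i)) ≗ (λ i → sub σ' (τ' i)) → sub σ (sub τ t) ≡ sub σ' (sub τ' t)
sub-sub-cong σ τ σ' τ' t h = trans (sub-sub σ τ t) (trans (sub-cong h t) (sym (sub-sub σ' τ' t)))

sub-wk-shift : {σ τ : ℕ → PTS S} → (λ i → σ (suc i)) ≗ τ → (t : PTS S) → sub σ (wk t) ≡ sub τ t
sub-wk-shift {σ = σ} h t = trans (sub-ren σ suc t) (sub-cong h t)

wk⟦⟧ : (t u : PTS S) → wk t ⟦ u ⟧ ≡ t
wk⟦⟧ t u = trans (sub-wk-shift (λ i → refl) t) (sub-id (λ i → refl) t)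

apps : PTS S → Vec (PTS S) n → PTS S
apps h ts = foldl app h (toList ts)

Bapps-apps : (h : PTS S) (Ms : Vec (Tm S) n) → Bapps h Ms ≡ apps h (Vec.map B Ms)
Bapps-apps h []       = refl
Bapps-apps h (M ∷ Ms) = Bapps-apps (app h (B M)) Ms

sub-ren-comm : (σ σ' : ℕ → PTS S) (ρ₁ ρ₂ : ℕ → ℕ) (t : PTS S) →
  (λ i → σ' (ρ₁ i)) ≗ (λ i → ren ρ₂ (σ i)) → sub σ' (ren ρ₁ t) ≡ ren ρ₂ (sub σ t)
sub-ren-comm σ σ' ρ₁ ρ₂ t h = trans (sub-ren σ' ρ₁ t) (trans (sub-cong h t) (sym (ren-sub ρ₂ σ t)))

-- B commutes with renaming (B^z(l) lives under the extra variable z); rules C1 and C5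
-- rename the body of a binder.  wkB-ren is the weakened form used inside B^z.
mutual
  B-ren : (ρ : ℕ → ℕ) (M : Tm S) → B (renT ρ M) ≡ ren ρ (B M)
  B-ren ρ (cPi A' B') = cong₂ pi (B-ren ρ A') (B-ren (ext ρ) B')
  B-ren ρ (cLam A' M) = cong₂ lam (B-ren ρ A') (B-ren (ext ρ) M)
  B-ren ρ (cSort s)   = refl
  B-ren ρ (cVar x l)  = trans (cong (_⟦ var (ρ x) ⟧) (Bl-ren ρ l))
    (sub-ren-comm _ _ (ext ρ) ρ (Bl l) (λ { zero → refl ; (suc i) → refl }))
  B-ren ρ (cApp M l)  = trans (cong₂ _⟦_⟧ (Bl-ren ρ l) (B-ren ρ M))
    (sub-ren-comm _ _ (ext ρ) ρ (Bl l) (λ { zero → refl ; (suc i) → refl }))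
  B-ren ρ (cSub P K M) = trans (cong₂ _⟦_⟧ (B-ren (ext ρ) M) (B-ren ρ P))
    (sub-ren-comm _ _ (ext ρ) ρ (B M) (λ { zero → refl ; (suc i) → refl }))
  B-ren ρ (cMeta a Ms) = Bapps-ren ρ (resα a _) Ms

  Bl-ren : (ρ : ℕ → ℕ) (l : Lst S) → Bl (renL ρ l) ≡ ren (ext ρ) (Bl l)
  Bl-ren ρ lNil         = refl
  Bl-ren ρ (lCons M l)  = trans (cong (sub _) (Bl-ren ρ l))
    (sub-ren-comm _ _ (ext ρ) (ext ρ) (Bl l)
      (λ { zero → cong (app (var zero)) (wkB-ren ρ M) ; (suc i) → refl }))
  Bl-ren ρ (lCat l l')  = trans (cong (sub _) (Bl-ren ρ l'))
    (sub-ren-comm _ _ (ext ρ) (ext ρ) (Bl l') (λ { zero → Bl-ren ρ l ; (suc i) → refl }))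
  Bl-ren ρ (lSub P K l) = trans (cong (sub _) (Bl-ren (ext ρ) l))
    (sub-ren-comm _ _ (ext (ext ρ)) (ext ρ) (Bl l)
      (λ { zero → refl ; (suc zero) → wkB-ren ρ P ; (suc (suc i)) → refl }))
  Bl-ren ρ (lMeta b Ms) = Bappsʷ-ren ρ (app (resβ b _) (var zero)) Ms

  wkB-ren : (ρ : ℕ → ℕ) (M : Tm S) → wk (B (renT ρ M)) ≡ ren (ext ρ) (wk (B M))
  wkB-ren ρ M = trans (cong wk (B-ren ρ M)) (sym (wk-ren ρ (B M)))

  Bapps-ren : (ρ : ℕ → ℕ) (h : PTS S) (Ms : Vec (Tm S) n) →
    Bapps (ren ρ h) (renV ρ Ms) ≡ ren ρ (Bapps h Ms)
  Bapps-ren ρ h []       = refl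
  Bapps-ren ρ h (M ∷ Ms) = trans (cong (λ z → Bapps (app (ren ρ h) z) (renV ρ Ms)) (B-ren ρ M))
    (Bapps-ren ρ (app h (B M)) Ms)

  Bappsʷ-ren : (ρ : ℕ → ℕ) (h : PTS S) (Ms : Vec (Tm S) n) →
    Bappsʷ (ren (ext ρ) h) (renV ρ Ms) ≡ ren (ext ρ) (Bappsʷ h Ms)
  Bappsʷ-ren ρ h []       = refl
  Bappsʷ-ren ρ h (M ∷ Ms) = trans (cong (λ z → Bappsʷ (app (ren (ext ρ) h) z) (renV ρ Ms)) (wkB-ren ρ M))
    (Bappsʷ-ren ρ (app h (wk (B M))) Ms)

Bl-cons : (M : Tm S) (l : Lst S) (t : PTS S) → Bl (lCons M l) ⟦ t ⟧ ≡ Bl l ⟦ app t (B M) ⟧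
Bl-cons M l t = trans (sub-sub _ _ (Bl l))
  (sub-cong (λ { zero → cong (app t) (wk⟦⟧ (B M) t) ; (suc i) → refl }) (Bl l))

Bl-cat : (l l' : Lst S) (t : PTS S) → Bl (lCat l l') ⟦ t ⟧ ≡ Bl l' ⟦ Bl l ⟦ t ⟧ ⟧
Bl-cat l l' t = trans (sub-sub _ _ (Bl l')) (sub-cong (λ { zero → refl ; (suc i) → refl }) (Bl l'))

Bappsʷ⟦⟧ : (h : PTS S) (Ms : Vec (Tm S) n) (t : PTS S) → Bappsʷ h Ms ⟦ t ⟧ ≡ apps (h ⟦ t ⟧) (Vec.map B Ms)
Bappsʷ⟦⟧ h []       t = refl
Bappsʷ⟦⟧ h (M ∷ Ms) t = trans (Bappsʷ⟦⟧ (app h (wk (B M))) Ms t)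
  (cong (λ z → apps (app (h ⟦ t ⟧) z) (Vec.map B Ms)) (wk⟦⟧ (B M) t))

Bl-meta : (b : ℕ) (Ms : Vec (Tm S) n) (t : PTS S) →
  Bl (lMeta b Ms) ⟦ t ⟧ ≡ apps (app (resβ b n) t) (Vec.map B Ms)
Bl-meta b Ms t = Bappsʷ⟦⟧ _ Ms t

B-underBinder : (σ : ℕ → PTS S) (P G M : Tm S) → σ zero ≡ B P → (λ i → σ (suc i)) ≗ var →
  B (cSub (wkT P) (wkT G) (renT swap M)) ≡ sub (exts σ) (B M)
B-underBinder σ P G M h₀ h₁ =
  trans (cong₂ _⟦_⟧ (B-ren swap M) (B-ren suc P))
    (trans (sub-ren _ swap (B M))
      (sub-cong (λ { zero → refl ; (suc zero) → cong wk (sym h₀) ; (suc (suc j)) → cong wk (sym (h₁ j)) })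
        (B M)))

-- B^z(⟨P/x⟩ l) substitutes wk B(P) for x (index 1) and fixes z (index 0) and the rest; on a
-- weakened argument B(M) this is the weakened instantiation B(M){x := B(P)} (rules D2, Dβ).
sub-wk-inst : (σ : ℕ → PTS S) (u t : PTS S) → σ (suc zero) ≡ wk u →
  (λ j → σ (suc (suc j))) ≗ (λ j → var (suc j)) → sub σ (wk t) ≡ wk (t ⟦ u ⟧)
sub-wk-inst σ u t h₁ h₂ = trans (sub-wk-shift (λ { zero → h₁ ; (suc j) → h₂ j }) t) (sym (ren-sub suc _ t))

sub-wk-fix : {σ : ℕ → PTS S} → (λ i → σ (suc i)) ≗ (λ i → var (suc i)) → (t : PTS S) → sub σ (wk t) ≡ wk t
sub-wk-fix h t = trans (sub-wk-shift h t) (sub-var (λ i → refl) t)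

Bapps⟦⟧ : (P G : Tm S) (h : PTS S) (Ms : Vec (Tm S) n) →
  Bapps h Ms ⟦ B P ⟧ ≡ Bapps (h ⟦ B P ⟧) (Vec.map (cSub P G) Ms)
Bapps⟦⟧ P G h []       = refl
Bapps⟦⟧ P G h (M ∷ Ms) = Bapps⟦⟧ P G (app h (B M)) Ms

Bappsʷ-sub : (σ : ℕ → PTS S) (P G : Tm S) → σ (suc zero) ≡ wk (B P) →
  (λ j → σ (suc (suc j))) ≗ (λ j → var (suc j)) →
  (h : PTS S) (Ms : Vec (Tm S) n) → sub σ (Bappsʷ h Ms) ≡ Bappsʷ (sub σ h) (Vec.map (cSub P G) Ms)
Bappsʷ-sub σ P G h₁ h₂ h []       = refl
Bappsʷ-sub σ P G h₁ h₂ h (M ∷ Ms) = trans (Bappsʷ-sub σ P G h₁ h₂ (app h (wk (B M))) Ms)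
  (cong (λ z → Bappsʷ (app (sub σ h) z) (Vec.map (cSub P G) Ms)) (sub-wk-inst σ (B P) (B M) h₁ h₂))

-- Every step of x' preserves the B-translation: for B1–B3 and A1–A4 this is the unit and
-- associativity laws of substitution, for C1–Cα and D1–Dβ pushing an instantiation inside.
mutual
  B-step : {M M' : Tm S} → M ⟶ M' → B M ≡ B M'
  B-step B1 = refl
  B-step (B2 {x} {l} {l'}) = sym (Bl-cat l l' (var x))
  B-step (B3 {M} {l} {l'}) = sym (Bl-cat l l' (B M))
  B-step (C1 {P} {G} {_} {M}) = cong (lam _) (sym (B-underBinder _ P G M refl (λ i → refl)))
  B-step (C2 {P} {G} {l}) = sub-sub-cong _ _ _ _ (Bl l)
    (λ { zero → refl ; (suc zero) → sym (wk⟦⟧ (B P) (B P)) ; (suc (suc j)) → refl })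
  B-step (C3 {P} {G} {x} {l}) = sub-sub-cong _ _ _ _ (Bl l)
    (λ { zero → refl ; (suc zero) → sym (wk⟦⟧ (B P) (var x)) ; (suc (suc j)) → refl })
  B-step (C4 {P} {G} {M} {l}) = sub-sub-cong _ _ _ _ (Bl l)
    (λ { zero → refl ; (suc zero) → sym (wk⟦⟧ (B P) _) ; (suc (suc j)) → refl })
  B-step (C5 {P} {G} {_} {M}) = cong (pi _) (sym (B-underBinder _ P G M refl (λ i → refl)))
  B-step C6 = refl
  B-step (Cα {P} {G} {a} {n} {Ms}) = Bapps⟦⟧ P G (resα a n) Ms
  B-step (piˡ s)  = cong (λ z → pi z _) (B-step s)
  B-step (piʳ s)  = cong (pi _) (B-step s)
  B-step (lamˡ s) = cong (λ z → lam z _) (B-step s)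
  B-step (lamʳ s) = cong (lam _) (B-step s)
  B-step (var {x} s)      = cong (_⟦ var x ⟧) (Bl-step s)
  B-step (appˡ {l = l} s) = cong (Bl l ⟦_⟧) (B-step s)
  B-step (appʳ {M} s)     = cong (_⟦ B M ⟧) (Bl-step s)
  B-step (sub₁ {M = M} s) = cong (B M ⟦_⟧) (B-step s)
  B-step (sub₂ s)         = refl
  B-step (sub₃ {N} s)     = cong (_⟦ B N ⟧) (B-step s)
  B-step (meta s)         = Bapps-step s _

  Bl-step : {l l' : Lst S} → l ⟶ₗ l' → Bl l ≡ Bl l'
  Bl-step (A1 {M} {l'} {l}) =
    sym (trans (sub-sub _ _ (Bl l)) (sub-cong (λ { zero → refl ; (suc i) → refl }) (Bl l)))
  Bl-step (A2 {l}) = sub-id (λ { zero → refl ; (suc i) → refl }) (Bl l)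
  Bl-step (A3 {l} {l'} {l''}) =
    sym (trans (sub-sub _ _ (Bl l'')) (sub-cong (λ { zero → refl ; (suc i) → refl }) (Bl l'')))
  Bl-step A4 = refl
  Bl-step D1 = refl
  Bl-step (D2 {P} {G} {M} {l}) = sub-sub-cong _ _ _ _ (Bl l)
    (λ { zero → cong (app (var zero)) (sub-wk-inst _ (B P) (B M) refl (λ j → refl))
       ; (suc zero) → sym (sub-wk-fix (λ i → refl) (B P))
       ; (suc (suc j)) → refl })
  Bl-step (D3 {P} {G} {l} {l'}) = sub-sub-cong _ _ _ _ (Bl l')
    (λ { zero → sub-cong (λ { zero → refl ; (suc zero) → refl ; (suc (suc j)) → refl }) (Bl l)
       ; (suc zero) → sym (sub-wk-fix (λ i → refl) (B P))
       ; (suc (suc j)) → refl })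
  Bl-step (Dβ {P} {G} {b} {n} {Ms}) = Bappsʷ-sub _ P G refl (λ j → refl) _ Ms
  Bl-step (consˡ {l = l} s) =
    sub-cong (λ { zero → cong (λ z → app (var zero) (wk z)) (B-step s) ; (suc i) → refl }) (Bl l)
  Bl-step (consʳ s)  = cong (sub _) (Bl-step s)
  Bl-step (catˡ {l₂ = l₂} s) = sub-cong (λ { zero → Bl-step s ; (suc i) → refl }) (Bl l₂)
  Bl-step (catʳ s)   = cong (sub _) (Bl-step s)
  Bl-step (sub₁ {l = l} s) =
    sub-cong (λ { zero → refl ; (suc zero) → cong wk (B-step s) ; (suc (suc j)) → refl }) (Bl l)
  Bl-step (sub₂ s)   = refl
  Bl-step (sub₃ s)   = cong (sub _) (Bl-step s)
  Bl-step (meta s)   = Bappsʷ-step s _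

  Bapps-step : {Ms Ms' : Vec (Tm S) n} → Ms ⟶ᵥ Ms' → (h : PTS S) → Bapps h Ms ≡ Bapps h Ms'
  Bapps-step (here {Ms = Ms} s) h = cong (λ z → Bapps (app h z) Ms) (B-step s)
  Bapps-step (there {M = M} s) h  = Bapps-step s (app h (B M))

  Bappsʷ-step : {Ms Ms' : Vec (Tm S) n} → Ms ⟶ᵥ Ms' → (h : PTS S) → Bappsʷ h Ms ≡ Bappsʷ h Ms'
  Bappsʷ-step (here {Ms = Ms} s) h = cong (λ z → Bappsʷ (app h (wk z)) Ms) (B-step s)
  Bappsʷ-step (there {M = M} s) h  = Bappsʷ-step s (app h (wk (B M)))

B-steps : {M M' : Tm S} → M ⟶* M' → B M ≡ B M'
B-steps ε        = refl
B-steps (s ◅ ss) = trans (B-step s) (B-steps ss)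

data Head {S : Set} : Tm S → Set where
  pi   : ∀ {X Y} → Head (cPi X Y)
  lam  : ∀ {X Y} → Head (cLam X Y)
  sort : ∀ {s} → Head (cSort s)
  meta : ∀ {a n} {Ms : Vec (Tm S) n} → Head (cMeta a Ms)

data NonNil {S : Set} : Lst S → Set where
  cons : ∀ {M l} → NonNil (lCons M l)
  meta : ∀ {b n} {Ms : Vec (Tm S) n} → NonNil (lMeta b Ms)
  cat  : ∀ {l l'} → NonNil (lCat l l')

mutual
  data NFt {S : Set} : Tm S → Set where
    pi   : ∀ {X Y} → NFt X → NFt Y → NFt (cPi X Y)
    lam  : ∀ {X Y} → NFt X → NFt Y → NFt (cLam X Y)
    sort : ∀ {s} → NFt (cSort s)
    var  : ∀ {x l} → NFl l → NFt (cVar x l)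
    app  : ∀ {M l} → Head M → NFt M → NFl l → NonNil l → NFt (cApp M l)
    meta : ∀ {a n} {Ms : Vec (Tm S) n} → NFv Ms → NFt (cMeta a Ms)

  data NFl {S : Set} : Lst S → Set where
    nil     : NFl lNil
    cons    : ∀ {M l} → NFt M → NFl l → NFl (lCons M l)
    meta    : ∀ {b n} {Ms : Vec (Tm S) n} → NFv Ms → NFl (lMeta b Ms)
    metaCat : ∀ {b n} {Ms : Vec (Tm S) n} {l} → NFv Ms → NFl l → NonNil l → NFl (lCat (lMeta b Ms) l)

  data NFv {S : Set} : Vec (Tm S) n → Set where
    []  : NFv []
    _∷_ : ∀ {M} {Ms : Vec (Tm S) n} → NFt M → NFv Ms → NFv (M ∷ Ms)

-- the case distinction behind rules A4 and B1
nil-or-nonNil : {l : Lst S} → NFl l → l ≡ lNil ⊎ NonNil l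
nil-or-nonNil nil             = inj₁ refl
nil-or-nonNil (cons _ _)      = inj₂ cons
nil-or-nonNil (meta _)        = inj₂ meta
nil-or-nonNil (metaCat _ _ _) = inj₂ cat

_⟶ₗ*_ : Lst S → Lst S → Set
_⟶ₗ*_ = Star _⟶ₗ_

_⟶ᵥ*_ : Vec (Tm S) n → Vec (Tm S) n → Set
_⟶ᵥ*_ = Star _⟶ᵥ_

HasNF : Tm S → Set
HasNF M = Σ[ N ∈ Tm _ ] (M ⟶* N × NFt N)

HasNFₗ : Lst S → Set
HasNFₗ l = Σ[ L ∈ Lst _ ] (l ⟶ₗ* L × NFl L)

HasNFᵥ : Vec (Tm S) n → Set
HasNFᵥ Ms = Σ[ Ns ∈ Vec (Tm _) _ ] (Ms ⟶ᵥ* Ns × NFv Ns)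

cat-nf : {l L : Lst S} → NFl l → NFl L →
  Σ[ L' ∈ Lst S ] (lCat l L ⟶ₗ* L' × NFl L' × (NonNil l → NonNil L'))
cat-nf nil nL = _ , A2 ◅ ε , nL , λ ()
cat-nf (cons m nl) nL with cat-nf nl nL
... | L' , r , nL' , _ = lCons _ L' , A1 ◅ gmap (lCons _) consʳ r , cons m nL' , λ _ → cons
cat-nf (meta v) nL with nil-or-nonNil nL
... | inj₁ refl = _ , A4 ◅ ε , meta v , λ _ → meta
... | inj₂ nn   = _ , ε , metaCat v nL nn , λ _ → cat
cat-nf (metaCat v nl nn) nL with cat-nf nl nL
... | L' , r , nL' , keep = _ , A3 ◅ gmap (lCat _) catʳ r , metaCat v nL' (keep nn) , λ _ → cat

head-app-nf : {M : Tm S} {L : Lst S} → Head M → NFt M → NFl L → HasNF (cApp M L)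
head-app-nf h m nL with nil-or-nonNil nL
... | inj₁ refl = _ , B1 ◅ ε , m
... | inj₂ nn   = _ , ε , app h m nL nn

app-nf : {M : Tm S} {L : Lst S} → NFt M → NFl L → HasNF (cApp M L)
app-nf (var nl) nL with cat-nf nl nL
... | _ , r , nL' , _ = _ , B2 ◅ gmap (cVar _) var r , var nL'
app-nf (app h m nl nn) nL with cat-nf nl nL
... | _ , r , nL' , keep = _ , B3 ◅ gmap (cApp _) appʳ r , app h m nL' (keep nn)
app-nf m@(pi _ _)  nL = head-app-nf pi m nL
app-nf m@(lam _ _) nL = head-app-nf lam m nL
app-nf m@sort      nL = head-app-nf sort m nL
app-nf m@(meta _)  nL = head-app-nf meta m nL

-- Size of PTSC terms; renaming preserves it, which bounds the recursion of rules C1 and C5.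
mutual
  sizeT : Tm S → ℕ
  sizeT (cPi X Y)    = suc (sizeT X + sizeT Y)
  sizeT (cLam X Y)   = suc (sizeT X + sizeT Y)
  sizeT (cSort s)    = 1
  sizeT (cVar x l)   = suc (sizeL l)
  sizeT (cApp M l)   = suc (sizeT M + sizeL l)
  sizeT (cSub P K M) = suc (sizeT P + sizeT M)
  sizeT (cMeta a Ms) = suc (sizeV Ms)

  sizeL : Lst S → ℕ
  sizeL lNil         = 1
  sizeL (lCons M l)  = suc (sizeT M + sizeL l)
  sizeL (lCat l l')  = suc (sizeL l + sizeL l')
  sizeL (lSub P K l) = suc (sizeT P + sizeL l)
  sizeL (lMeta b Ms) = suc (sizeV Ms)

  sizeV : Vec (Tm S) n → ℕ
  sizeV []       = 0
  sizeV (M ∷ Ms) = sizeT M + sizeV Ms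

mutual
  sizeT-ren : (ρ : ℕ → ℕ) (M : Tm S) → sizeT (renT ρ M) ≡ sizeT M
  sizeT-ren ρ (cPi X Y)    = cong₂ (λ a b → suc (a + b)) (sizeT-ren ρ X) (sizeT-ren (ext ρ) Y)
  sizeT-ren ρ (cLam X Y)   = cong₂ (λ a b → suc (a + b)) (sizeT-ren ρ X) (sizeT-ren (ext ρ) Y)
  sizeT-ren ρ (cSort s)    = refl
  sizeT-ren ρ (cVar x l)   = cong suc (sizeL-ren ρ l)
  sizeT-ren ρ (cApp M l)   = cong₂ (λ a b → suc (a + b)) (sizeT-ren ρ M) (sizeL-ren ρ l)
  sizeT-ren ρ (cSub P K M) = cong₂ (λ a b → suc (a + b)) (sizeT-ren ρ P) (sizeT-ren (ext ρ) M)
  sizeT-ren ρ (cMeta a Ms) = cong suc (sizeV-ren ρ Ms)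

  sizeL-ren : (ρ : ℕ → ℕ) (l : Lst S) → sizeL (renL ρ l) ≡ sizeL l
  sizeL-ren ρ lNil         = refl
  sizeL-ren ρ (lCons M l)  = cong₂ (λ a b → suc (a + b)) (sizeT-ren ρ M) (sizeL-ren ρ l)
  sizeL-ren ρ (lCat l l')  = cong₂ (λ a b → suc (a + b)) (sizeL-ren ρ l) (sizeL-ren ρ l')
  sizeL-ren ρ (lSub P K l) = cong₂ (λ a b → suc (a + b)) (sizeT-ren ρ P) (sizeL-ren (ext ρ) l)
  sizeL-ren ρ (lMeta b Ms) = cong suc (sizeV-ren ρ Ms)

  sizeV-ren : (ρ : ℕ → ℕ) (Ms : Vec (Tm S) n) → sizeV (renV ρ Ms) ≡ sizeV Ms
  sizeV-ren ρ []       = refl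
  sizeV-ren ρ (M ∷ Ms) = cong₂ _+_ (sizeT-ren ρ M) (sizeV-ren ρ Ms)

Head-ren : (ρ : ℕ → ℕ) {M : Tm S} → Head M → Head (renT ρ M)
Head-ren ρ pi   = pi
Head-ren ρ lam  = lam
Head-ren ρ sort = sort
Head-ren ρ meta = meta

NonNil-ren : (ρ : ℕ → ℕ) {l : Lst S} → NonNil l → NonNil (renL ρ l)
NonNil-ren ρ cons = cons
NonNil-ren ρ meta = meta
NonNil-ren ρ cat  = cat

mutual
  NFt-ren : (ρ : ℕ → ℕ) {M : Tm S} → NFt M → NFt (renT ρ M)
  NFt-ren ρ (pi a b)        = pi (NFt-ren ρ a) (NFt-ren (ext ρ) b)
  NFt-ren ρ (lam a b)       = lam (NFt-ren ρ a) (NFt-ren (ext ρ) b)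
  NFt-ren ρ sort            = sort
  NFt-ren ρ (var nl)        = var (NFl-ren ρ nl)
  NFt-ren ρ (app h m nl nn) = app (Head-ren ρ h) (NFt-ren ρ m) (NFl-ren ρ nl) (NonNil-ren ρ nn)
  NFt-ren ρ (meta v)        = meta (NFv-ren ρ v)

  NFl-ren : (ρ : ℕ → ℕ) {l : Lst S} → NFl l → NFl (renL ρ l)
  NFl-ren ρ nil                = nil
  NFl-ren ρ (cons m nl)        = cons (NFt-ren ρ m) (NFl-ren ρ nl)
  NFl-ren ρ (meta v)           = meta (NFv-ren ρ v)
  NFl-ren ρ (metaCat v nl nn)  = metaCat (NFv-ren ρ v) (NFl-ren ρ nl) (NonNil-ren ρ nn)

  NFv-ren : (ρ : ℕ → ℕ) {Ms : Vec (Tm S) n} → NFv Ms → NFv (renV ρ Ms)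
  NFv-ren ρ []      = []
  NFv-ren ρ (m ∷ v) = NFt-ren ρ m ∷ NFv-ren ρ v

pi* : {X X' Y Y' : Tm S} → X ⟶* X' → Y ⟶* Y' → cPi X Y ⟶* cPi X' Y'
pi* r₁ r₂ = gmap (λ z → cPi z _) piˡ r₁ ◅◅ gmap (cPi _) piʳ r₂

lam* : {X X' Y Y' : Tm S} → X ⟶* X' → Y ⟶* Y' → cLam X Y ⟶* cLam X' Y'
lam* r₁ r₂ = gmap (λ z → cLam z _) lamˡ r₁ ◅◅ gmap (cLam _) lamʳ r₂

app* : {M M' : Tm S} {l l' : Lst S} → M ⟶* M' → l ⟶ₗ* l' → cApp M l ⟶* cApp M' l'
app* r₁ r₂ = gmap (λ z → cApp z _) appˡ r₁ ◅◅ gmap (cApp _) appʳ r₂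

sub* : {P P' G M M' : Tm S} → P ⟶* P' → M ⟶* M' → cSub P G M ⟶* cSub P' G M'
sub* r₁ r₂ = gmap (λ z → cSub z _ _) sub₁ r₁ ◅◅ gmap (cSub _ _) sub₃ r₂

cons* : {M M' : Tm S} {l l' : Lst S} → M ⟶* M' → l ⟶ₗ* l' → lCons M l ⟶ₗ* lCons M' l'
cons* r₁ r₂ = gmap (λ z → lCons z _) consˡ r₁ ◅◅ gmap (lCons _) consʳ r₂

cat* : {l₁ l₁' l₂ l₂' : Lst S} → l₁ ⟶ₗ* l₁' → l₂ ⟶ₗ* l₂' → lCat l₁ l₂ ⟶ₗ* lCat l₁' l₂'
cat* r₁ r₂ = gmap (λ z → lCat z _) catˡ r₁ ◅◅ gmap (lCat _) catʳ r₂

lsub* : {P P' G : Tm S} {l l' : Lst S} → P ⟶* P' → l ⟶ₗ* l' → lSub P G l ⟶ₗ* lSub P' G l'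
lsub* r₁ r₂ = gmap (λ z → lSub z _ _) sub₁ r₁ ◅◅ gmap (lSub _ _) sub₃ r₂

vcons* : {M M' : Tm S} {Ms Ms' : Vec (Tm S) n} → M ⟶* M' → Ms ⟶ᵥ* Ms' → (M ∷ Ms) ⟶ᵥ* (M' ∷ Ms')
vcons* r₁ r₂ = gmap (λ z → z ∷ _) here r₁ ◅◅ gmap (_ ∷_) there r₂

swap-bound : {f : ℕ} (X Y : Tm S) → sizeT X + sizeT Y ≤ f → sizeT (renT swap Y) ≤ f
swap-bound X Y le = subst (_≤ _) (sym (sizeT-ren swap Y)) (m+n≤o⇒n≤o (sizeT X) le)

mutual
  sub-nf : (f : ℕ) {P : Tm S} (G : Tm S) {M : Tm S} → NFt P → NFt M → sizeT M ≤ f → HasNF (cSub P G M)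
  sub-nf (suc f) G {cPi X Y} p (pi x y) (s≤s le)
    with sub-nf f G p x (m+n≤o⇒m≤o _ le)
       | sub-nf f (wkT G) (NFt-ren suc p) (NFt-ren swap y) (swap-bound X Y le)
  ... | _ , r₁ , n₁ | _ , r₂ , n₂ = _ , C5 ◅ pi* r₁ r₂ , pi n₁ n₂
  sub-nf (suc f) G {cLam X Y} p (lam x y) (s≤s le)
    with sub-nf f G p x (m+n≤o⇒m≤o _ le)
       | sub-nf f (wkT G) (NFt-ren suc p) (NFt-ren swap y) (swap-bound X Y le)
  ... | _ , r₁ , n₁ | _ , r₂ , n₂ = _ , C1 ◅ lam* r₁ r₂ , lam n₁ n₂
  sub-nf (suc f) G p sort _ = _ , C6 ◅ ε , sort
  sub-nf (suc f) G {cVar zero l} p (var nl) (s≤s le) with sub-nfₗ f G p nl le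
  ... | _ , r , nL with app-nf p nL
  ...   | _ , r' , n = _ , C2 ◅ gmap (cApp _) appʳ r ◅◅ r' , n
  sub-nf (suc f) G {cVar (suc x) l} p (var nl) (s≤s le) with sub-nfₗ f G p nl le
  ... | _ , r , nL = _ , C3 ◅ gmap (cVar x) var r , var nL
  sub-nf (suc f) G {cApp M l} p (app _ m nl _) (s≤s le)
    with sub-nf f G p m (m+n≤o⇒m≤o _ le) | sub-nfₗ f G p nl (m+n≤o⇒n≤o (sizeT M) le)
  ... | _ , r₁ , n₁ | _ , r₂ , n₂ with app-nf n₁ n₂
  ...   | _ , r , n = _ , C4 ◅ app* r₁ r₂ ◅◅ r , n
  sub-nf (suc f) G p (meta v) (s≤s le) with sub-nfᵥ f G p v le
  ... | _ , r , n = _ , Cα ◅ gmap (cMeta _) meta r , meta n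

  sub-nfₗ : (f : ℕ) {P : Tm S} (G : Tm S) {l : Lst S} → NFt P → NFl l → sizeL l ≤ f → HasNFₗ (lSub P G l)
  sub-nfₗ (suc f) G p nil _ = _ , D1 ◅ ε , nil
  sub-nfₗ (suc f) G {lCons M l} p (cons m nl) (s≤s le)
    with sub-nf f G p m (m+n≤o⇒m≤o _ le) | sub-nfₗ f G p nl (m+n≤o⇒n≤o (sizeT M) le)
  ... | _ , r₁ , n₁ | _ , r₂ , n₂ = _ , D2 ◅ cons* r₁ r₂ , cons n₁ n₂
  sub-nfₗ (suc f) G p (meta v) (s≤s le) with sub-nfᵥ f G p v le
  ... | _ , r , n = _ , Dβ ◅ gmap (lMeta _) meta r , meta n
  sub-nfₗ (suc f) G {lCat l l'} p (metaCat v nl _) (s≤s le)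
    with sub-nfₗ f G p (meta v) (m+n≤o⇒m≤o _ le) | sub-nfₗ f G p nl (m+n≤o⇒n≤o (sizeL l) le)
  ... | _ , r₁ , n₁ | _ , r₂ , n₂ with cat-nf n₁ n₂
  ...   | _ , r , n , _ = _ , D3 ◅ cat* r₁ r₂ ◅◅ r , n

  sub-nfᵥ : (f : ℕ) {P : Tm S} (G : Tm S) {Ms : Vec (Tm S) n} → NFt P → NFv Ms → sizeV Ms ≤ f →
    HasNFᵥ (Vec.map (cSub P G) Ms)
  sub-nfᵥ f G p [] _ = _ , ε , []
  sub-nfᵥ f G {M ∷ Ms} p (m ∷ v) le
    with sub-nf f G p m (m+n≤o⇒m≤o _ le) | sub-nfᵥ f G p v (m+n≤o⇒n≤o (sizeT M) le)
  ... | _ , r₁ , n₁ | _ , r₂ , n₂ = _ , vcons* r₁ r₂ , n₁ ∷ n₂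

mutual
  normalise : (M : Tm S) → HasNF M
  normalise (cPi X Y) with normalise X | normalise Y
  ... | _ , r₁ , n₁ | _ , r₂ , n₂ = _ , pi* r₁ r₂ , pi n₁ n₂
  normalise (cLam X Y) with normalise X | normalise Y
  ... | _ , r₁ , n₁ | _ , r₂ , n₂ = _ , lam* r₁ r₂ , lam n₁ n₂
  normalise (cSort s) = _ , ε , sort
  normalise (cVar x l) with normaliseₗ l
  ... | _ , r , n = _ , gmap (cVar x) var r , var n
  normalise (cApp M l) with normalise M | normaliseₗ l
  ... | _ , r₁ , n₁ | _ , r₂ , n₂ with app-nf n₁ n₂
  ...   | _ , r , n = _ , app* r₁ r₂ ◅◅ r , n
  normalise (cSub P K M) with normalise P | normalise M
  ... | _ , r₁ , n₁ | M' , r₂ , n₂ with sub-nf (sizeT M') K n₁ n₂ ≤-refl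
  ...   | _ , r , n = _ , sub* r₁ r₂ ◅◅ r , n
  normalise (cMeta a Ms) with normaliseᵥ Ms
  ... | _ , r , n = _ , gmap (cMeta a) meta r , meta n

  normaliseₗ : (l : Lst S) → HasNFₗ l
  normaliseₗ lNil = _ , ε , nil
  normaliseₗ (lCons M l) with normalise M | normaliseₗ l
  ... | _ , r₁ , n₁ | _ , r₂ , n₂ = _ , cons* r₁ r₂ , cons n₁ n₂
  normaliseₗ (lCat l l') with normaliseₗ l | normaliseₗ l'
  ... | _ , r₁ , n₁ | _ , r₂ , n₂ with cat-nf n₁ n₂
  ...   | _ , r , n , _ = _ , cat* r₁ r₂ ◅◅ r , n
  normaliseₗ (lSub P K l) with normalise P | normaliseₗ l
  ... | _ , r₁ , n₁ | l' , r₂ , n₂ with sub-nfₗ (sizeL l') K n₁ n₂ ≤-refl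
  ...   | _ , r , n = _ , lsub* r₁ r₂ ◅◅ r , n
  normaliseₗ (lMeta b Ms) with normaliseᵥ Ms
  ... | _ , r , n = _ , gmap (lMeta b) meta r , meta n

  normaliseᵥ : (Ms : Vec (Tm S) n) → HasNFᵥ Ms
  normaliseᵥ [] = _ , ε , []
  normaliseᵥ (M ∷ Ms) with normalise M | normaliseᵥ Ms
  ... | _ , r₁ , n₁ | _ , r₂ , n₂ = _ , vcons* r₁ r₂ , n₁ ∷ n₂

hd : PTS S → PTS S
hd t = proj₁ (spine t)

args : PTS S → List (PTS S)
args t = proj₂ (spine t)

spine-foldl : (t : PTS S) → t ≡ foldl app (hd t) (args t)
spine-foldl (app t u)  = trans (cong (λ z → app z u) (spine-foldl t)) (sym (foldl-∷ʳ app (hd t) u (args t)))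
spine-foldl (var x)    = refl
spine-foldl (resα a k) = refl
spine-foldl (resβ b k) = refl
spine-foldl (sort s)   = refl
spine-foldl (pi T U)   = refl
spine-foldl (lam T t)  = refl

hd-foldl : (h : PTS S) (xs : List (PTS S)) → hd (foldl app h xs) ≡ hd h
hd-foldl h []       = refl
hd-foldl h (x ∷ xs) = hd-foldl (app h x) xs

args-foldl : (h : PTS S) (xs : List (PTS S)) → args (foldl app h xs) ≡ args h ++ xs
args-foldl h []       = sym (++-identityʳ (args h))
args-foldl h (x ∷ xs) = trans (args-foldl (app h x) xs) (++-assoc (args h) [ x ] xs)

hd-not-app : (t : PTS S) {x y : PTS S} → hd t ≢ app x y
hd-not-app (app t u) = hd-not-app t
hd-not-app (var _)    ()
hd-not-app (resα _ _) ()
hd-not-app (resβ _ _) ()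
hd-not-app (sort _)   ()
hd-not-app (pi _ _)   ()
hd-not-app (lam _ _)  ()

MetaSpine : Set → Set
MetaSpine S = Maybe (Σ ℕ λ a → Σ ℕ λ k → Vec (PTS S) k)

ListMetaSpine : Set → Set
ListMetaSpine S = Maybe (Σ ℕ λ b → Σ ℕ λ k → PTS S × Vec (PTS S) k)

isαᴴ : PTS S → List (PTS S) → MetaSpine S
isαᴴ (resα a k) xs = Maybe.map (λ v → a , k , v) (exactly k xs)
isαᴴ _          _  = nothing

isβᴴ : PTS S → List (PTS S) → ListMetaSpine S
isβᴴ (resβ b k) (t₀ ∷ xs) = Maybe.map (λ v → b , k , t₀ , v) (exactly k xs)
isβᴴ _          _         = nothing

isα-spine : (t : PTS S) → isα t ≡ isαᴴ (hd t) (args t)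
isα-spine t with spine t
... | resα a k , xs = refl
... | var x    , xs = refl
... | resβ b k , xs = refl
... | sort s   , xs = refl
... | pi T U   , xs = refl
... | lam T U  , xs = refl
... | app u v  , xs = refl

isβ-spine : (t : PTS S) → isβ t ≡ isβᴴ (hd t) (args t)
isβ-spine t with spine t
... | resβ b k , []       = refl
... | resβ b k , (_ ∷ xs) = refl
... | var x    , xs = refl
... | resα a k , xs = refl
... | sort s   , xs = refl
... | pi T U   , xs = refl
... | lam T U  , xs = refl
... | app u v  , xs = refl

exactly-toList : {X : Set} (v : Vec X n) → exactly n (toList v) ≡ just v
exactly-toList []      = refl
exactly-toList (x ∷ v) = cong (Maybe.map (x ∷_)) (exactly-toList v)

exactly-just : {X : Set} (k : ℕ) (xs : List X) {v : Vec X k} → exactly k xs ≡ just v → xs ≡ toList v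
exactly-just zero    []       refl = refl
exactly-just (suc k) (x ∷ xs) e with exactly k xs in e'
exactly-just (suc k) (x ∷ xs) refl | just w = cong (x ∷_) (exactly-just k xs e')

exactly-just-length : {X : Set} (k : ℕ) (xs : List X) {v : Vec X k} → exactly k xs ≡ just v → length xs ≡ k
exactly-just-length k xs {v} e = trans (cong length (exactly-just k xs e)) (length-toList v)

exactly-length : {X : Set} (k : ℕ) (xs : List X) → length xs ≡ k → exactly k xs ≢ nothing
exactly-length zero    []       _ ()
exactly-length (suc k) (x ∷ xs) e with exactly k xs in e'
... | just _  = λ ()
... | nothing = ⊥-elim (exactly-length k xs (suc-injective e) e')

isα-inv : (t : PTS S) {a k : ℕ} {ts : Vec (PTS S) k} → isα t ≡ just (a , k , ts) → t ≡ apps (resα a k) ts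
isα-inv t e = trans (spine-foldl t) (head (hd t) (args t) (trans (sym (isα-spine t)) e))
  where
  head : (h : PTS S) (xs : List (PTS S)) {a k : ℕ} {ts : Vec (PTS S) k} →
    isαᴴ h xs ≡ just (a , k , ts) → foldl app h xs ≡ apps (resα a k) ts
  head (resα a k) xs e with exactly k xs in e'
  head (resα a k) xs refl | just v = cong (foldl app _) (exactly-just k xs e')

isβ-inv : (t : PTS S) {b k : ℕ} {t₀ : PTS S} {ts : Vec (PTS S) k} →
  isβ t ≡ just (b , k , t₀ , ts) → t ≡ apps (app (resβ b k) t₀) ts
isβ-inv t e = trans (spine-foldl t) (head (hd t) (args t) (trans (sym (isβ-spine t)) e))
  where
  head : (h : PTS S) (xs : List (PTS S)) {b k : ℕ} {t₀ : PTS S} {ts : Vec (PTS S) k} →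
    isβᴴ h xs ≡ just (b , k , t₀ , ts) → foldl app h xs ≡ apps (app (resβ b k) t₀) ts
  head (resβ b k) (t₀ ∷ xs) e with exactly k xs in e'
  head (resβ b k) (t₀ ∷ xs) refl | just v = cong (foldl app _) (exactly-just k xs e')

isα-apps : (a : ℕ) (ts : Vec (PTS S) n) → isα (apps (resα a n) ts) ≡ just (a , n , ts)
isα-apps {n = n} a ts = begin
  isα (apps h ts)                          ≡⟨ isα-spine (apps h ts) ⟩
  isαᴴ (hd (apps h ts)) (args (apps h ts))
    ≡⟨ cong₂ isαᴴ (hd-foldl h (toList ts)) (args-foldl h (toList ts)) ⟩
  isαᴴ h (toList ts)                       ≡⟨ cong (Maybe.map (λ v → a , n , v)) (exactly-toList ts) ⟩
  just (a , n , ts)                        ∎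
  where open ≡-Reasoning
        h = resα a n

isβ-apps : (b : ℕ) (t₀ : PTS S) (ts : Vec (PTS S) n) →
  isβ (apps (app (resβ b n) t₀) ts) ≡ just (b , n , t₀ , ts)
isβ-apps {n = n} b t₀ ts = begin
  isβ (apps h ts)                          ≡⟨ isβ-spine (apps h ts) ⟩
  isβᴴ (hd (apps h ts)) (args (apps h ts))
    ≡⟨ cong₂ isβᴴ (hd-foldl h (toList ts)) (args-foldl h (toList ts)) ⟩
  isβᴴ (resβ b n) (t₀ ∷ toList ts)         ≡⟨ cong (Maybe.map (λ v → b , n , t₀ , v)) (exactly-toList ts) ⟩
  just (b , n , t₀ , ts)                   ∎
  where open ≡-Reasoning
        h = app (resβ b n) t₀

isα-βapps : (b : ℕ) (t₀ : PTS S) (ts : Vec (PTS S) n) → isα (apps (app (resβ b n) t₀) ts) ≡ nothing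
isα-βapps {n = n} b t₀ ts =
  trans (isα-spine (apps h ts)) (cong₂ isαᴴ (hd-foldl h (toList ts)) (args-foldl h (toList ts)))
  where h = app (resβ b n) t₀

WF-foldl→ : (m : ℕ) (h : PTS S) (xs : List (PTS S)) →
  WFα m (foldl app h xs) → WFα (m + length xs) h × All (WFα 0) xs
WF-foldl→ m h []       w = subst (λ z → WFα z h) (sym (+-identityʳ m)) w , []
WF-foldl→ m h (x ∷ xs) w with WF-foldl→ m (app h x) xs w
... | (wh , wx) , wxs = subst (λ z → WFα z h) (sym (+-suc m (length xs))) wh , wx ∷ wxs

WF-foldl← : (m : ℕ) (h : PTS S) (xs : List (PTS S)) →
  WFα (m + length xs) h → All (WFα 0) xs → WFα m (foldl app h xs)
WF-foldl← m h []       wh []         = subst (λ z → WFα z h) (+-identityʳ m) wh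
WF-foldl← m h (x ∷ xs) wh (wx ∷ wxs) =
  WF-foldl← m (app h x) xs (subst (λ z → WFα z h) (+-suc m (length xs)) wh , wx) wxs

WF-spine→ : (m : ℕ) (t : PTS S) → WFα m t → WFα (m + length (args t)) (hd t) × All (WFα 0) (args t)
WF-spine→ m t w = WF-foldl→ m (hd t) (args t) (subst (WFα m) (spine-foldl t) w)

length-snoc : {X : Set} (xs : List X) (x : X) → length (xs ++ [ x ]) ≡ suc (length xs)
length-snoc xs x = trans (length-++ xs) (+-comm (length xs) 1)

unsaturated : (h : PTS S) (ys : List (PTS S)) {m : ℕ} → WFα m h → length ys ≡ suc m →
  isαᴴ h ys ≡ nothing × isβᴴ h ys ≡ nothing
unsaturated (resα a k) ys {m} k≤m len with exactly k ys in e
... | just _  = ⊥-elim (1+n≰n (subst (_≤ m) (trans (sym (exactly-just-length k ys e)) len) k≤m))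
... | nothing = refl , refl
unsaturated (resβ b k) (t₀ ∷ ys) {m} k<m len with exactly k ys in e
... | just _  =
  ⊥-elim (1+n≰n (subst (λ z → suc z ≤ m) (trans (sym (exactly-just-length k ys e)) (suc-injective len)) k<m))
... | nothing = refl , refl
unsaturated (resβ b k) [] w ()
unsaturated (var x)    ys w len = refl , refl
unsaturated (sort s)   ys w len = refl , refl
unsaturated (pi T U)   ys w len = refl , refl
unsaturated (lam T t)  ys w len = refl , refl
unsaturated (app t u)  ys w len = refl , refl

saturate-or-drop : (h : PTS S) (ys : List (PTS S)) {m : ℕ} → (∀ {x y} → h ≢ app x y) →
  WFα (suc m) h → isαᴴ h ys ≡ nothing → isβᴴ h ys ≡ nothing → length ys ≡ suc m → WFα m h
saturate-or-drop (var x)    ys ¬app w eα eβ len = tt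
saturate-or-drop (sort s)   ys ¬app w eα eβ len = tt
saturate-or-drop (pi T U)   ys ¬app w eα eβ len = w
saturate-or-drop (lam T t)  ys ¬app w eα eβ len = w
saturate-or-drop (app t u)  ys ¬app w eα eβ len = ⊥-elim (¬app refl)
saturate-or-drop (resα a k) ys {m} ¬app k≤1+m eα eβ len with k ≟ suc m
... | no k≢1+m = ≤-pred (≤∧≢⇒< k≤1+m k≢1+m)
... | yes refl with exactly (suc m) ys in e
...   | just _  = case eα of λ ()
...   | nothing = ⊥-elim (exactly-length (suc m) ys len e)
saturate-or-drop (resβ b k) [] ¬app w eα eβ ()
saturate-or-drop (resβ b k) (t₀ ∷ ys) {m} ¬app 1+k≤1+m eα eβ len with k ≟ m
... | no k≢m = ≤∧≢⇒< (≤-pred 1+k≤1+m) (λ { refl → k≢m refl })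
... | yes refl with exactly k ys in e
...   | just _  = case eβ of λ ()
...   | nothing = ⊥-elim (exactly-length k ys (suc-injective len) e)

app-not-meta : (t u : PTS S) → WFα 0 t → isα (app t u) ≡ nothing × isβ (app t u) ≡ nothing
app-not-meta t u w
  with unsaturated (hd t) (args t ++ [ u ]) (proj₁ (WF-spine→ 0 t w)) (length-snoc (args t) u)
... | eα , eβ = trans (isα-spine (app t u)) eα , trans (isβ-spine (app t u)) eβ

fun-WF : (t u : PTS S) → WFα 1 t → isα (app t u) ≡ nothing → isβ (app t u) ≡ nothing → WFα 0 t
fun-WF t u w eα eβ with WF-spine→ 1 t w
... | wh , wxs = subst (WFα 0) (sym (spine-foldl t))
  (WF-foldl← 0 (hd t) (args t)
    (saturate-or-drop (hd t) (args t ++ [ u ]) (hd-not-app t) wh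
      (trans (sym (isα-spine (app t u))) eα) (trans (sym (isβ-spine (app t u))) eβ)
      (length-snoc (args t) u))
    wxs)

size-foldl-head : (h : PTS S) (xs : List (PTS S)) → size h ≤ size (foldl app h xs)
size-foldl-head h []       = ≤-refl
size-foldl-head h (x ∷ xs) =
  ≤-trans (≤-trans (n≤1+n _) (s≤s (m≤m+n (size h) (size x)))) (size-foldl-head (app h x) xs)

size-foldl-args : (h : PTS S) (xs : List (PTS S)) → All (λ x → size x < size (foldl app h xs)) xs
size-foldl-args h []       = []
size-foldl-args h (x ∷ xs) =
  ≤-trans (s≤s (m≤n+m (size x) (size h))) (size-foldl-head (app h x) xs) ∷ size-foldl-args (app h x) xs

SmallerWF : PTS S → PTS S → Set
SmallerWF t x = WFα 0 x × size x < size t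

meta-parts : (t : PTS S) {a k : ℕ} {ts : Vec (PTS S) k} → isα t ≡ just (a , k , ts) → WFα 0 t →
  All (SmallerWF t) (toList ts)
meta-parts t {a} {k} {ts} e w with isα-inv t e
... | refl = All.zip (proj₂ (WF-foldl→ 0 (resα a k) (toList ts) w) , size-foldl-args _ (toList ts))

metaList-parts : (t : PTS S) {b k : ℕ} {t₀ : PTS S} {ts : Vec (PTS S) k} →
  isβ t ≡ just (b , k , t₀ , ts) → WFα 0 t → SmallerWF t t₀ × All (SmallerWF t) (toList ts)
metaList-parts t {b} {k} {t₀} {ts} e w with isβ-inv t e
... | refl with WF-foldl→ 0 (app (resβ b k) t₀) (toList ts) w
...   | (_ , w₀) , ws = (w₀ , ≤-trans (s≤s (n≤1+n (size t₀))) (size-foldl-head _ (toList ts)))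
                      , All.zip (ws , size-foldl-args _ (toList ts))

-- Fuel arithmetic: A is run with fuel 3·size t; passing to a strictly smaller component
-- costs at most 3 units of fuel, so the bound 3·size is preserved.
fuel-shrink : {a b : ℕ} (j m : ℕ) → j ≤ 3 → a < b → 3 * b ≤ j + m → 3 * a ≤ m
fuel-shrink {a} {b} j m j≤3 a<b h = +-cancelˡ-≤ 3 _ _ (begin
  3 + 3 * a ≡⟨ sym (*-suc 3 a) ⟩
  3 * suc a ≤⟨ *-monoʳ-≤ 3 a<b ⟩
  3 * b     ≤⟨ h ⟩
  j + m     ≤⟨ +-monoˡ-≤ m j≤3 ⟩
  3 + m     ∎)
  where open ≤-Reasoning

fuel₁ : {a b m : ℕ} → a < b → 3 * b ≤ 1 + m → 3 * a ≤ m
fuel₁ {m = m} = fuel-shrink 1 m (s≤s z≤n)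

fuel₂ : {a b m : ℕ} → a < b → 3 * b ≤ 2 + m → 3 * a ≤ m
fuel₂ {m = m} = fuel-shrink 2 m (s≤s (s≤s z≤n))

fuel₃ : {a b m : ℕ} → a < b → 3 * b ≤ 3 + m → 3 * a ≤ m
fuel₃ {m = m} = fuel-shrink 3 m ≤-refl

fuel-min : (t : PTS S) {m : ℕ} → 3 * size t ≤ m → 3 ≤ m
fuel-min t = ≤-trans (*-monoʳ-≤ 3 (size-pos t))
  where
  size-pos : (t : PTS S) → 1 ≤ size t
  size-pos (var x)    = s≤s z≤n
  size-pos (resα a k) = s≤s z≤n
  size-pos (resβ b k) = s≤s z≤n
  size-pos (sort s)   = s≤s z≤n
  size-pos (pi T U)   = s≤s z≤n
  size-pos (lam T t)  = s≤s z≤n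
  size-pos (app t u)  = s≤s z≤n

infix 4 _⇝_ _⇝[_]_ _⇝ᵛ_

-- Keeping the test
-- results as indices makes the clauses syntactically disjoint, so the graph is functional.
mutual
  data GraphA {S : Set} : PTS S → MetaSpine S → ListMetaSpine S → Tm S → Set where
    sort     : ∀ {s} → GraphA (sort s) nothing nothing (cSort s)
    pi       : ∀ {T U A' B'} → T ⇝ A' → U ⇝ B' → GraphA (pi T U) nothing nothing (cPi A' B')
    lam      : ∀ {T t A' M} → T ⇝ A' → t ⇝ M → GraphA (lam T t) nothing nothing (cLam A' M)
    var      : ∀ {x} → GraphA (var x) nothing nothing (cVar x lNil)
    meta     : ∀ {t a k mβ} {ts : Vec (PTS S) k} {Ms} → ts ⇝ᵛ Ms →
               GraphA t (just (a , k , ts)) mβ (cMeta a Ms)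
    metaList : ∀ {t b k t₀ M} {ts : Vec (PTS S) k} {Ms} → ts ⇝ᵛ Ms → t₀ ⇝[ lMeta b Ms ] M →
               GraphA t nothing (just (b , k , t₀ , ts)) M
    asList   : ∀ {t u M} → GraphAₗ lNil (app t u) nothing nothing M → GraphA (app t u) nothing nothing M

  data GraphAₗ {S : Set} : Lst S → PTS S → MetaSpine S → ListMetaSpine S → Tm S → Set where
    sort     : ∀ {l s} → GraphAₗ l (sort s) nothing nothing (cApp (cSort s) l)
    pi       : ∀ {l T U A' B'} → T ⇝ A' → U ⇝ B' → GraphAₗ l (pi T U) nothing nothing (cApp (cPi A' B') l)
    lam      : ∀ {l T t A' M} → T ⇝ A' → t ⇝ M → GraphAₗ l (lam T t) nothing nothing (cApp (cLam A' M) l)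
    var      : ∀ {l x} → GraphAₗ l (var x) nothing nothing (cVar x l)
    meta     : ∀ {l t a k mβ} {ts : Vec (PTS S) k} {Ms} → ts ⇝ᵛ Ms →
               GraphAₗ l t (just (a , k , ts)) mβ (cApp (cMeta a Ms) l)
    metaList : ∀ {l t b k t₀ M} {ts : Vec (PTS S) k} {Ms} → ts ⇝ᵛ Ms → t₀ ⇝[ lCat (lMeta b Ms) l ] M →
               GraphAₗ l t nothing (just (b , k , t₀ , ts)) M
    app      : ∀ {l t u N M} → u ⇝ N → t ⇝[ lCons N l ] M → GraphAₗ l (app t u) nothing nothing M

  data _⇝ᵛ_ {S : Set} : Vec (PTS S) n → Vec (Tm S) n → Set where
    []  : [] ⇝ᵛ []
    _∷_ : ∀ {t M} {ts : Vec (PTS S) n} {Ms} → t ⇝ M → ts ⇝ᵛ Ms → (t ∷ ts) ⇝ᵛ (M ∷ Ms)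

  _⇝_ : PTS S → Tm S → Set
  t ⇝ M = GraphA t (isα t) (isβ t) M

  _⇝[_]_ : PTS S → Lst S → Tm S → Set
  t ⇝[ l ] M = GraphAₗ l t (isα t) (isβ t) M

meta⇝ : {t : PTS S} {a k : ℕ} {ts : Vec (PTS S) k} {Ms : Vec (Tm S) k} →
  isα t ≡ just (a , k , ts) → ts ⇝ᵛ Ms → t ⇝ cMeta a Ms
meta⇝ eα ps rewrite eα = meta ps

metaList⇝ : {t t₀ : PTS S} {b k : ℕ} {ts : Vec (PTS S) k} {Ms : Vec (Tm S) k} {M : Tm S} →
  isα t ≡ nothing → isβ t ≡ just (b , k , t₀ , ts) → ts ⇝ᵛ Ms → t₀ ⇝[ lMeta b Ms ] M → t ⇝ M
metaList⇝ eα eβ ps g rewrite eα | eβ = metaList ps g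

asList⇝ : {t u : PTS S} {M : Tm S} → isα (app t u) ≡ nothing → isβ (app t u) ≡ nothing →
  app t u ⇝[ lNil ] M → app t u ⇝ M
asList⇝ eα eβ g rewrite eα | eβ = asList g

metaₗ⇝ : {l : Lst S} {t : PTS S} {a k : ℕ} {ts : Vec (PTS S) k} {Ms : Vec (Tm S) k} →
  isα t ≡ just (a , k , ts) → ts ⇝ᵛ Ms → t ⇝[ l ] cApp (cMeta a Ms) l
metaₗ⇝ eα ps rewrite eα = meta ps

metaListₗ⇝ : {l : Lst S} {t t₀ : PTS S} {b k : ℕ} {ts : Vec (PTS S) k} {Ms : Vec (Tm S) k} {M : Tm S} →
  isα t ≡ nothing → isβ t ≡ just (b , k , t₀ , ts) → ts ⇝ᵛ Ms → t₀ ⇝[ lCat (lMeta b Ms) l ] M → t ⇝[ l ] M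
metaListₗ⇝ eα eβ ps g rewrite eα | eβ = metaList ps g

appₗ⇝ : {l : Lst S} {t u : PTS S} {N M : Tm S} → isα (app t u) ≡ nothing → isβ (app t u) ≡ nothing →
  u ⇝ N → t ⇝[ lCons N l ] M → app t u ⇝[ l ] M
appₗ⇝ eα eβ g₁ g₂ rewrite eα | eβ = app g₁ g₂

left< : (a b : ℕ) → a < suc (a + b)
left< a b = s≤s (m≤m+n a b)

right< : (a b : ℕ) → b < suc (a + b)
right< a b = s≤s (m≤n+m b a)

mutual
  Aₙ-graph : (n : ℕ) (t : PTS S) → WFα 0 t → 3 * size t ≤ n → t ⇝ Aₙ n t
  Aₙ-graph zero t w h = case fuel-min t h of λ ()
  Aₙ-graph (suc n) (sort s) w h = sort
  Aₙ-graph (suc n) (pi T U) (wT , wU) h =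
    pi (Aₙ-graph n T wT (fuel₁ (left< (size T) (size U)) h))
       (Aₙ-graph n U wU (fuel₁ (right< (size T) (size U)) h))
  Aₙ-graph (suc n) (lam T t) (wT , wt) h =
    lam (Aₙ-graph n T wT (fuel₁ (left< (size T) (size t)) h))
        (Aₙ-graph n t wt (fuel₁ (right< (size T) (size t)) h))
  Aₙ-graph (suc zero) (var x) w (s≤s ())
  Aₙ-graph (suc (suc n)) (var x) w h = var
  Aₙ-graph (suc n) (resα a .0) z≤n h = meta []
  Aₙ-graph (suc n) (app t u) w h with isα (app t u) in eα | isβ (app t u) in eβ
  ... | just _ | _ = meta (Aₙ-graphᵥ n {app t u} _ (λ lt → fuel₁ lt h) (meta-parts (app t u) eα w))
  ... | nothing | just _ with metaList-parts (app t u) eβ w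
  ...   | (w₀ , lt₀) , ps = metaList (Aₙ-graphᵥ n {app t u} _ (λ lt → fuel₁ lt h) ps)
                                     (Aₗₙ-graph n _ _ w₀ (≤-trans (fuel₁ lt₀ h) (n≤1+n n)))
  Aₙ-graph (suc n) (app t u) w h | nothing | nothing =
    asList (subst₂ (λ α? β? → GraphAₗ lNil (app t u) α? β? (Aₗₙ n lNil (app t u))) eα eβ
                   (Aₗₙ-graph n lNil (app t u) w h))

  Aₗₙ-graph : (n : ℕ) (l : Lst S) (t : PTS S) → WFα 0 t → 3 * size t ≤ suc n → t ⇝[ l ] Aₗₙ n l t
  Aₗₙ-graph zero l t w h = case fuel-min t h of λ { (s≤s ()) }
  Aₗₙ-graph (suc zero) l t w h = case fuel-min t h of λ { (s≤s (s≤s ())) }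
  Aₗₙ-graph (suc (suc n)) l (sort s) w h = sort
  Aₗₙ-graph (suc (suc n)) l (pi T U) (wT , wU) h =
    pi (Aₙ-graph n T wT (fuel₃ (left< (size T) (size U)) h))
       (Aₙ-graph n U wU (fuel₃ (right< (size T) (size U)) h))
  Aₗₙ-graph (suc (suc n)) l (lam T t) (wT , wt) h =
    lam (Aₙ-graph n T wT (fuel₃ (left< (size T) (size t)) h))
        (Aₙ-graph n t wt (fuel₃ (right< (size T) (size t)) h))
  Aₗₙ-graph (suc (suc n)) l (var x) w h = var
  Aₗₙ-graph (suc (suc n)) l (resα a .0) z≤n h = meta []
  Aₗₙ-graph (suc n) l (app t u) w h with isα (app t u) in eα | isβ (app t u) in eβ
  ... | just _ | _ = meta (Aₙ-graphᵥ n {app t u} _ (λ lt → fuel₂ lt h) (meta-parts (app t u) eα w))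
  ... | nothing | just _ with metaList-parts (app t u) eβ w
  ...   | (w₀ , lt₀) , ps = metaList (Aₙ-graphᵥ n {app t u} _ (λ lt → fuel₂ lt h) ps)
                                     (Aₗₙ-graph n _ _ w₀ (fuel₁ lt₀ h))
  Aₗₙ-graph (suc n) l (app t u) (wt , wu) h | nothing | nothing =
    app (Aₙ-graph n u wu (fuel₂ (right< (size t) (size u)) h))
        (Aₗₙ-graph n _ t (fun-WF t u wt eα eβ) (fuel₁ (left< (size t) (size u)) h))

  Aₙ-graphᵥ : (n : ℕ) {t : PTS S} (ts : Vec (PTS S) n') → ({a : ℕ} → a < size t → 3 * a ≤ n) →
    All (SmallerWF t) (toList ts) → ts ⇝ᵛ Vec.map (Aₙ n) ts
  Aₙ-graphᵥ n []       bound []             = []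
  Aₙ-graphᵥ n (x ∷ ts) bound ((w , lt) ∷ ps) = Aₙ-graph n x w (bound lt) ∷ Aₙ-graphᵥ n ts bound ps

A-graph : (t : PTS S) → PTSα t → t ⇝ A t
A-graph t w = Aₙ-graph (3 * size t) t w ≤-refl

mutual
  graph-functional : {t : PTS S} {α? : MetaSpine S} {β? : ListMetaSpine S} {M M' : Tm S} →
    GraphA t α? β? M → GraphA t α? β? M' → M ≡ M'
  graph-functional sort        sort          = refl
  graph-functional (pi g₁ g₂)  (pi g₁' g₂')  =
    cong₂ cPi (graph-functional g₁ g₁') (graph-functional g₂ g₂')
  graph-functional (lam g₁ g₂) (lam g₁' g₂') =
    cong₂ cLam (graph-functional g₁ g₁') (graph-functional g₂ g₂')
  graph-functional var         var           = refl
  graph-functional (meta ps)   (meta ps')    = cong (cMeta _) (graphᵥ-functional ps ps')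
  graph-functional (metaList ps g) (metaList ps' g') with graphᵥ-functional ps ps'
  ... | refl = graphₗ-functional g g'
  graph-functional (asList g)  (asList g')   = graphₗ-functional g g'

  graphₗ-functional : {l : Lst S} {t : PTS S} {α? : MetaSpine S} {β? : ListMetaSpine S} {M M' : Tm S} →
    GraphAₗ l t α? β? M → GraphAₗ l t α? β? M' → M ≡ M'
  graphₗ-functional sort sort = refl
  graphₗ-functional {l = l} (pi g₁ g₂) (pi g₁' g₂') =
    cong (λ z → cApp z l) (cong₂ cPi (graph-functional g₁ g₁') (graph-functional g₂ g₂'))
  graphₗ-functional {l = l} (lam g₁ g₂) (lam g₁' g₂') =
    cong (λ z → cApp z l) (cong₂ cLam (graph-functional g₁ g₁') (graph-functional g₂ g₂'))
  graphₗ-functional var var = refl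
  graphₗ-functional {l = l} (meta ps) (meta ps') =
    cong (λ z → cApp (cMeta _ z) l) (graphᵥ-functional ps ps')
  graphₗ-functional (metaList ps g) (metaList ps' g') with graphᵥ-functional ps ps'
  ... | refl = graphₗ-functional g g'
  graphₗ-functional (app g₁ g₂) (app g₁' g₂') with graph-functional g₁ g₁'
  ... | refl = graphₗ-functional g₂ g₂'

  graphᵥ-functional : {ts : Vec (PTS S) n} {Ms Ms' : Vec (Tm S) n} → ts ⇝ᵛ Ms → ts ⇝ᵛ Ms' → Ms ≡ Ms'
  graphᵥ-functional []       []         = refl
  graphᵥ-functional (g ∷ ps) (g' ∷ ps') = cong₂ _∷_ (graph-functional g g') (graphᵥ-functional ps ps')

mutual
  graph-B : {t : PTS S} {α? : MetaSpine S} {β? : ListMetaSpine S} {M : Tm S} →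
    GraphA t α? β? M → isα t ≡ α? → isβ t ≡ β? → B M ≡ t
  graph-B sort        _  _  = refl
  graph-B (pi g₁ g₂)  _  _  = cong₂ pi (⇝-B g₁) (⇝-B g₂)
  graph-B (lam g₁ g₂) _  _  = cong₂ lam (⇝-B g₁) (⇝-B g₂)
  graph-B var         _  _  = refl
  graph-B (meta ps)   eα _  = meta-B eα ps
  graph-B (metaList ps g) eα eβ = trans (⇝ₗ-B g) (metaList-B eβ ps)
  graph-B (asList g)  eα eβ = graphₗ-B g eα eβ

  graphₗ-B : {l : Lst S} {t : PTS S} {α? : MetaSpine S} {β? : ListMetaSpine S} {M : Tm S} →
    GraphAₗ l t α? β? M → isα t ≡ α? → isβ t ≡ β? → B M ≡ Bl l ⟦ t ⟧
  graphₗ-B sort          _ _ = refl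
  graphₗ-B {l = l} (pi g₁ g₂)  _ _ = cong (Bl l ⟦_⟧) (cong₂ pi (⇝-B g₁) (⇝-B g₂))
  graphₗ-B {l = l} (lam g₁ g₂) _ _ = cong (Bl l ⟦_⟧) (cong₂ lam (⇝-B g₁) (⇝-B g₂))
  graphₗ-B var           _ _ = refl
  graphₗ-B {l = l} (meta ps) eα _ = cong (Bl l ⟦_⟧) (meta-B eα ps)
  graphₗ-B {l = l} {t} {M = M} (metaList {b = b} {t₀ = t₀} {Ms = Ms} ps g) eα eβ = begin
    B M                                 ≡⟨ ⇝ₗ-B g ⟩
    Bl (lCat (lMeta b Ms) l) ⟦ t₀ ⟧     ≡⟨ Bl-cat (lMeta b Ms) l t₀ ⟩
    Bl l ⟦ Bl (lMeta b Ms) ⟦ t₀ ⟧ ⟧     ≡⟨ cong (Bl l ⟦_⟧) (metaList-B eβ ps) ⟩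
    Bl l ⟦ t ⟧                          ∎
    where open ≡-Reasoning
  graphₗ-B {l = l} {M = M} (app {t = t} {u} {N} g₁ g₂) eα eβ = begin
    B M                                 ≡⟨ ⇝ₗ-B g₂ ⟩
    Bl (lCons N l) ⟦ t ⟧                ≡⟨ Bl-cons N l t ⟩
    Bl l ⟦ app t (B N) ⟧                ≡⟨ cong (λ z → Bl l ⟦ app t z ⟧) (⇝-B g₁) ⟩
    Bl l ⟦ app t u ⟧                    ∎
    where open ≡-Reasoning

  graphᵥ-B : {ts : Vec (PTS S) n} {Ms : Vec (Tm S) n} → ts ⇝ᵛ Ms → Vec.map B Ms ≡ ts
  graphᵥ-B []       = refl
  graphᵥ-B (g ∷ ps) = cong₂ _∷_ (⇝-B g) (graphᵥ-B ps)

  ⇝-B : {t : PTS S} {M : Tm S} → t ⇝ M → B M ≡ t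
  ⇝-B g = graph-B g refl refl

  ⇝ₗ-B : {l : Lst S} {t : PTS S} {M : Tm S} → t ⇝[ l ] M → B M ≡ Bl l ⟦ t ⟧
  ⇝ₗ-B g = graphₗ-B g refl refl

  meta-B : {t : PTS S} {a k : ℕ} {ts : Vec (PTS S) k} {Ms : Vec (Tm S) k} →
    isα t ≡ just (a , k , ts) → ts ⇝ᵛ Ms → B (cMeta a Ms) ≡ t
  meta-B {t = t} {a} {k} {ts} {Ms} eα ps = begin
    Bapps (resα a k) Ms                 ≡⟨ Bapps-apps (resα a k) Ms ⟩
    apps (resα a k) (Vec.map B Ms)      ≡⟨ cong (apps (resα a k)) (graphᵥ-B ps) ⟩
    apps (resα a k) ts                  ≡⟨ sym (isα-inv t eα) ⟩
    t                                   ∎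
    where open ≡-Reasoning

  metaList-B : {t t₀ : PTS S} {b k : ℕ} {ts : Vec (PTS S) k} {Ms : Vec (Tm S) k} →
    isβ t ≡ just (b , k , t₀ , ts) → ts ⇝ᵛ Ms → Bl (lMeta b Ms) ⟦ t₀ ⟧ ≡ t
  metaList-B {t = t} {t₀} {b} {k} {ts} {Ms} eβ ps = begin
    Bl (lMeta b Ms) ⟦ t₀ ⟧                   ≡⟨ Bl-meta b Ms t₀ ⟩
    apps (app (resβ b k) t₀) (Vec.map B Ms)  ≡⟨ cong (apps (app (resβ b k) t₀)) (graphᵥ-B ps) ⟩
    apps (app (resβ b k) t₀) ts              ≡⟨ sym (isβ-inv t eβ) ⟩
    t                                        ∎
    where open ≡-Reasoning

WF-mono : {m m' : ℕ} (t : PTS S) → m ≤ m' → WFα m t → WFα m' t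
WF-mono (var x)    le w        = tt
WF-mono (resα a k) le w        = ≤-trans w le
WF-mono (resβ b k) le w        = ≤-trans w le
WF-mono (sort s)   le w        = w
WF-mono (pi T U)   le w        = w
WF-mono (lam T t)  le w        = w
WF-mono (app t u)  le (wt , wu) = WF-mono t (s≤s le) wt , wu

WF-apps : (m : ℕ) (h : PTS S) (ts : Vec (PTS S) n) →
  WFα (m + n) h → All (WFα 0) (toList ts) → WFα m (apps h ts)
WF-apps {n = n} m h ts wh wts =
  WF-foldl← m h (toList ts) (subst (λ z → WFα (m + z) h) (sym (length-toList ts)) wh) wts

mutual
  WF-B : {M : Tm S} → NFt M → PTSα (B M)
  WF-B (pi a b)        = WF-B a , WF-B b
  WF-B (lam a b)       = WF-B a , WF-B b
  WF-B sort            = tt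
  WF-B (var nl)        = WF-applied nl tt
  WF-B (app _ m nl _)  = WF-applied nl (WF-B m)
  WF-B (meta {a} {n} {Ms} v) =
    subst (WFα 0) (sym (Bapps-apps (resα a n) Ms)) (WF-apps 0 (resα a n) (Vec.map B Ms) ≤-refl (WF-Bᵥ v))

  WF-Bᵥ : {Ms : Vec (Tm S) n} → NFv Ms → All (WFα 0) (toList (Vec.map B Ms))
  WF-Bᵥ []      = []
  WF-Bᵥ (m ∷ v) = WF-B m ∷ WF-Bᵥ v

  WF-applied : {l : Lst S} {t : PTS S} → NFl l → PTSα t → PTSα (Bl l ⟦ t ⟧)
  WF-applied nil w = w
  WF-applied {t = t} (cons {M} {l} m nl) w =
    subst (WFα 0) (sym (Bl-cons M l t)) (WF-applied nl (WF-mono t z≤n w , WF-B m))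
  WF-applied {t = t} (meta {b} {n} {Ms} v) w =
    subst (WFα 0) (sym (Bl-meta b Ms t))
      (WF-apps 0 (app (resβ b n) t) (Vec.map B Ms) (≤-refl , w) (WF-Bᵥ v))
  WF-applied {t = t} (metaCat {b} {n} {Ms} {l} v nl _) w =
    subst (WFα 0) (sym (Bl-cat (lMeta b Ms) l t)) (WF-applied nl (WF-applied (meta v) w))

mutual
  nf-graph : {M : Tm S} → NFt M → B M ⇝ M
  nf-graph (pi a b)  = pi (nf-graph a) (nf-graph b)
  nf-graph (lam a b) = lam (nf-graph a) (nf-graph b)
  nf-graph sort      = sort
  nf-graph (var nl) with nil-or-nonNil nl
  ... | inj₁ refl = var
  ... | inj₂ nn   = applied-graph nl nn tt var
  nf-graph (app h m nl nn) = applied-graph nl nn (WF-B m) (head-graph h m)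
  nf-graph (meta {a} {n} {Ms} v) =
    subst (_⇝ cMeta a Ms) (sym (Bapps-apps (resα a n) Ms)) (meta⇝ (isα-apps a (Vec.map B Ms)) (nf-graphᵥ v))

  nf-graphᵥ : {Ms : Vec (Tm S) n} → NFv Ms → Vec.map B Ms ⇝ᵛ Ms
  nf-graphᵥ []      = []
  nf-graphᵥ (m ∷ v) = nf-graph m ∷ nf-graphᵥ v

  head-graph : {l : Lst S} {M : Tm S} → Head M → NFt M → B M ⇝[ l ] cApp M l
  head-graph pi   (pi a b)  = pi (nf-graph a) (nf-graph b)
  head-graph lam  (lam a b) = lam (nf-graph a) (nf-graph b)
  head-graph sort sort      = sort
  head-graph {l = l} meta (meta {a} {n} {Ms} v) =
    subst (_⇝[ l ] cApp (cMeta a Ms) l) (sym (Bapps-apps (resα a n) Ms))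
      (metaₗ⇝ (isα-apps a (Vec.map B Ms)) (nf-graphᵥ v))

  applied-graph : {l : Lst S} {t : PTS S} {M : Tm S} → NFl l → NonNil l → PTSα t →
    t ⇝[ l ] M → Bl l ⟦ t ⟧ ⇝ M
  applied-graph {t = t} {M} (cons {N} {l} n nl) _ w g with app-not-meta t (B N) w | nil-or-nonNil nl
  ... | nα , nβ | inj₁ refl = subst (_⇝ M) (sym (Bl-cons N lNil t))
    (asList⇝ nα nβ (appₗ⇝ nα nβ (nf-graph n) g))
  ... | nα , nβ | inj₂ nn = subst (_⇝ M) (sym (Bl-cons N l t))
    (applied-graph nl nn (WF-mono t z≤n w , WF-B n) (appₗ⇝ nα nβ (nf-graph n) g))
  applied-graph {t = t} {M} (meta {b} {n} {Ms} v) _ w g = subst (_⇝ M) (sym (Bl-meta b Ms t))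
    (metaList⇝ (isα-βapps b t (Vec.map B Ms)) (isβ-apps b t (Vec.map B Ms)) (nf-graphᵥ v) g)
  applied-graph {t = t} {M} (metaCat {b} {n} {Ms} {l} v nl nn) _ w g =
    subst (_⇝ M) (sym (Bl-cat (lMeta b Ms) l t)) (applied-graph nl nn (WF-applied (meta v) w)
      (subst (_⇝[ l ] M) (sym (Bl-meta b Ms t))
        (metaListₗ⇝ (isα-βapps b t (Vec.map B Ms)) (isβ-apps b t (Vec.map B Ms)) (nf-graphᵥ v) g)))

theorem2p7 : {S : Set} →
    ((t : PTS S) → PTSα t → B (A t) ≡ t) × ((M : Tm S) → M ⟶* A (B M))
theorem2p7 {S} = part1 , part2
  where
  part1 : (t : PTS S) → PTSα t → B (A t) ≡ t
  part1 t w = ⇝-B (A-graph t w)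

  -- (2) M reduces to a normal form N; B is invariant under reduction, and A(B(N)) = N since
  --     both are values of the functional graph of A at B(N).
  part2 : (M : Tm S) → M ⟶* A (B M)
  part2 M with normalise M
  ... | N , M⟶*N , nfN = subst (M ⟶*_) N≡ABM M⟶*N
    where
    N≡ABM : N ≡ A (B M)
    N≡ABM = begin
      N         ≡⟨ graph-functional (nf-graph nfN) (A-graph (B N) (WF-B nfN)) ⟩
      A (B N)   ≡⟨ cong A (sym (B-steps M⟶*N)) ⟩
      A (B M)   ∎
      where open ≡-Reasoning
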